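{- Let $G$ be a graph of order $n$ and let $k$ be a non-negative integer. Then $\mathrm{mis}_{\leq k}(G)\leq 3^{4k-n}4^{n-3k}$, with equality if and only if $G$ is the disjoint union of $k$ graphs, each of which is a copy of $K_3$ or of $K_4$.
   Context: All graphs are finite, simple and undirected. For a graph $G$, $\mathrm{mis}_{\leq k}(G)$ denotes the number of maximal independent sets $I$ of $G$ (independent sets not properly contained in another independent set) with $|I|\leq k$. -}

module Defs where

open import Data.Nat using (ℕ; zero; suc; _+_; _≤?_; _≤_)
open import Data.Bool using (Bool; true; false)
open import Data.Fin using (Fin; _≟_)
open import Data.Fin.Subset using (Subset; _∈_; _∉_; _⊆_; ∣_∣; inside; outside)
open import Data.Fin.Subset.Properties using (_∈?_; _⊆?_; anySubset?)
open import Data.Fin.Properties using (all?)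
open import Data.Vec using (_∷_; []; tabulate)
open import Data.Product using (Σ; ∃; _×_; _,_)
open import Data.Sum using (_⊎_)
open import Function.Bundles using (_⇔_)
open import Relation.Nullary using (Dec; yes; no; ¬_; does)
open import Relation.Nullary.Decidable using (_×-dec_; _→-dec_; ¬?)
open import Relation.Binary.PropositionalEquality using (_≡_; _≢_)

record Graph (n : ℕ) : Set₁ where
  field
    Adj     : Fin n → Fin n → Set
    adj?    : ∀ u v → Dec (Adj u v)
    sym     : ∀ {u v} → Adj u v → Adj v u
    irrefl  : ∀ {u} → ¬ Adj u u
open Graph public

module _ {n : ℕ} (G : Graph n) where

  Independent : Subset n → Set
  Independent S = ∀ u v → u ∈ S → v ∈ S → ¬ Adj G u v

  MaximalIndependent : Subset n → Set
  MaximalIndependent S = Independent S × (∀ T → Independent T → S ⊆ T → T ⊆ S)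

  independent? : ∀ S → Dec (Independent S)
  independent? S = all? λ u → all? λ v →
    (u ∈? S) →-dec ((v ∈? S) →-dec ¬? (adj? G u v))

  private
    forallSubset? : {P : Subset n → Set} → (∀ T → Dec (P T)) → Dec (∀ T → P T)
    forallSubset? {P} P? with anySubset? (λ T → ¬? (P? T))
    ... | yes (T , ¬pT) = no λ all → ¬pT (all T)
    ... | no ¬ex = yes λ T → helper T
      where
      helper : ∀ T → P T
      helper T with P? T
      ... | yes p = p
      ... | no ¬p = Data.Empty.⊥-elim (¬ex (T , ¬p))
        where import Data.Empty

  maximalIndependent? : ∀ S → Dec (MaximalIndependent S)
  maximalIndependent? S = independent? S ×-dec
    forallSubset? (λ T → independent? T →-dec ((S ⊆? T) →-dec (T ⊆? S)))

countSubsets : ∀ {n} → (Subset n → Bool) → ℕ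
countSubsets {zero}  p = if' (p [])
  where
  if' : Bool → ℕ
  if' true  = 1
  if' false = 0
countSubsets {suc n} p = countSubsets (λ S → p (inside ∷ S)) + countSubsets (λ S → p (outside ∷ S))

mis≤ : ∀ {n} → Graph n → ℕ → ℕ
mis≤ G k = countSubsets (λ S → does (maximalIndependent? G S ×-dec (∣ S ∣ ≤? k)))

-- G is the disjoint union of k graphs, each a copy of K₃ or K₄:
-- there is a labelling c of the vertices by k components such that every
-- component has exactly 3 or 4 vertices, and two vertices are adjacent
-- iff they are distinct and lie in the same component.
IsDisjointUnionOfK3K4 : ∀ {n} → Graph n → ℕ → Set
IsDisjointUnionOfK3K4 {n} G k =
  Σ (Fin n → Fin k) λ c →
    (∀ (i : Fin k) → ∣ tabulate (λ v → does (c v ≟ i)) ∣ ≡ 3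
                   ⊎ ∣ tabulate (λ v → does (c v ≟ i)) ∣ ≡ 4)
    × (∀ u v → Adj G u v ⇔ (u ≢ v × c u ≡ c v))

{-# OPTIONS --safe #-}
module Submission where

open import Defs hiding (sym)
open import Data.Nat using (ℕ; zero; suc; _+_; _*_; _^_; _∸_; _⊓_; _≤_; _<_; z≤n; s≤s; _≤?_; _≟_; >-nonZero)
open import Data.Nat.Properties
open import Data.Nat.Tactic.RingSolver using (solve-∀)
open import Algebra.Properties.Semiring.Sum +-*-semiring using (sum; *-distribˡ-sum; *-distribʳ-sum)
open import Data.Bool using (Bool; true; false; _∧_; _∨_; not; if_then_else_)
open import Data.Bool.Properties using () renaming (_≟_ to _≟ᵇ_)
open import Data.Fin using (Fin; zero; suc; toℕ; fromℕ<) renaming (_≟_ to _≟ᶠ_)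
open import Data.Fin.Properties using (all?; any?; toℕ-fromℕ<; toℕ-injective; toℕ<n)
open import Data.Fin.Subset using (Subset; inside; outside; ∣_∣)
import Data.Fin.Subset as Subset
open import Data.Vec using ([]; _∷_; lookup; tabulate; replicate; _[_]≔_)
open import Data.Vec.Properties
  using (lookup∘update; lookup∘update′; lookup∘tabulate; lookup-replicate; []=⇒lookup; lookup⇒[]=)
open import Data.Product using (Σ; ∃; _×_; _,_; proj₁; proj₂)
open import Data.Sum using (_⊎_; inj₁; inj₂) renaming (map to ⊎-map)
open import Data.Empty using (⊥; ⊥-elim)
open import Function.Bundles using (_⇔_; mk⇔; Equivalence)
open import Function.Construct.Composition using (_⇔-∘_)
open import Function.Construct.Symmetry using (⇔-sym)
open import Relation.Nullary using (Dec; yes; no; ¬_; does)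
open import Relation.Nullary.Decidable
  using (dec-true; dec-false; decidable-stable; toWitness; _×-dec_; _→-dec_; _⊎-dec_; ¬?)
open import Relation.Binary.PropositionalEquality

-- Generalise to induced subgraphs G[A] and prove the bound together with its equality case by
-- induction on k.  Write f(m, k) = 3^(4k−m) 4^(m−3k); let v have minimum degree in G[A],
-- D = N[v] ∩ A and d = |D|.  Every maximal independent set of G[A] meets D, and those that
-- contain u ∈ D are, after deleting u, the maximal independent sets of G[A ∖ N[u]] with one
-- vertex fewer.  With μ_u = |N[u] ∩ A| ≥ d this gives
--   mis≤(k+1)(G[A]) ≤ Σ_{u ∈ D} f(|A| − μ_u, k)   and   d f(m − μ, k) ≤ (64/81) μ (3/4)^μ f(m, k+1),
-- and j (3/4)^j ≤ 81/64 with equality exactly for j = 3, 4.  In the equality case the families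
-- counted for different u ∈ D are disjoint, every u ∈ D has μ = d ∈ {3, 4}, and every
-- G[A ∖ N[u]] is extremal, hence by induction a union of K₃'s and K₄'s.  Every vertex of such a
-- graph lies in a small maximal independent set, so disjointness forces D to be a clique, and
-- then the equal degrees force it to be a component of G[A].

dec-true⁻¹ : ∀ {P : Set} (p : Dec P) → does p ≡ true → P
dec-true⁻¹ (yes p) _ = p

dec-false⁻¹ : ∀ {P : Set} (p : Dec P) → does p ≡ false → ¬ P
dec-false⁻¹ (no ¬p) _ = ¬p

does-⇔ : ∀ {P Q : Set} (p : Dec P) (q : Dec Q) → (P → Q) → (Q → P) → does p ≡ does q
does-⇔ (yes _) (yes _) _ _ = refl
does-⇔ (yes p) (no ¬q) f _ = ⊥-elim (¬q (f p))
does-⇔ (no ¬p) (yes q) _ g = ⊥-elim (¬p (g q))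
does-⇔ (no _)  (no _)  _ _ = refl

bool-ext : ∀ {a b} → (a ≡ true → b ≡ true) → (b ≡ true → a ≡ true) → a ≡ b
bool-ext {false} {false} _ _ = refl
bool-ext {false} {true}  _ g = g refl
bool-ext {true}  {false} f _ = sym (f refl)
bool-ext {true}  {true}  _ _ = refl

true⊎false : ∀ b → b ≡ true ⊎ b ≡ false
true⊎false true  = inj₁ refl
true⊎false false = inj₂ refl

true≢false : ∀ {a} → a ≡ true → a ≡ false → ⊥
true≢false refl ()

≢true⇒≡false : ∀ {a} → ¬ (a ≡ true) → a ≡ false
≢true⇒≡false {false} _ = refl
≢true⇒≡false {true}  h = ⊥-elim (h refl)

≢false⇒≡true : ∀ {a} → ¬ (a ≡ false) → a ≡ true
≢false⇒≡true {true}  _ = refl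
≢false⇒≡true {false} h = ⊥-elim (h refl)

∧-trueˡ : ∀ {a b} → a ∧ b ≡ true → a ≡ true
∧-trueˡ {true} _ = refl

∧-trueʳ : ∀ {a b} → a ∧ b ≡ true → b ≡ true
∧-trueʳ {true} e = e

∧-true : ∀ {a b} → a ≡ true → b ≡ true → a ∧ b ≡ true
∧-true refl refl = refl

not-true : ∀ {a} → not a ≡ true → a ≡ false
not-true {false} _ = refl

not-false : ∀ {a} → a ≡ false → not a ≡ true
not-false refl = refl

∧-not-∧ : ∀ a b → a ∧ not b ≡ a ∧ not (a ∧ b)
∧-not-∧ true  b = refl
∧-not-∧ false b = refl

-- Finite sets as Boolean predicates

∈⇒lookup : ∀ {n} {T : Subset n} {u} → u Subset.∈ T → lookup T u ≡ true
∈⇒lookup = []=⇒lookup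

lookup⇒∈ : ∀ {n} {T : Subset n} {u} → lookup T u ≡ true → u Subset.∈ T
lookup⇒∈ {T = T} {u} = lookup⇒[]= u T

lookup-insert : ∀ {n} (T : Subset n) u → lookup (T [ u ]≔ inside) u ≡ true
lookup-insert T u = lookup∘update u T inside

lookup-insert-≢ : ∀ {n} (T : Subset n) {u w} → w ≢ u → lookup (T [ u ]≔ inside) w ≡ lookup T w
lookup-insert-≢ T w≢u = lookup∘update′ w≢u T inside

lookup-insert⁻¹ : ∀ {n} (T : Subset n) u w → lookup (T [ u ]≔ inside) w ≡ true →
  w ≡ u ⊎ (w ≢ u × lookup T w ≡ true)
lookup-insert⁻¹ T u w Tw with w ≟ᶠ u
... | yes w≡u = inj₁ w≡u
... | no  w≢u = inj₂ (w≢u , trans (sym (lookup-insert-≢ T w≢u)) Tw)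

infixl 7 _∩_
infixl 6 _∖_

_∩_ : ∀ {n} → (Fin n → Bool) → (Fin n → Bool) → (Fin n → Bool)
(f ∩ g) w = f w ∧ g w

_∖_ : ∀ {n} → (Fin n → Bool) → (Fin n → Bool) → (Fin n → Bool)
(f ∖ g) w = f w ∧ not (g w)

_⊆ᵇ_ : ∀ {n} → (Fin n → Bool) → (Fin n → Bool) → Set
f ⊆ᵇ g = ∀ w → f w ≡ true → g w ≡ true

card : ∀ {n} → (Fin n → Bool) → ℕ
card {zero}  f = 0
card {suc n} f = (if f zero then suc else λ m → m) (card (λ i → f (suc i)))

card-cong : ∀ {n} {f g : Fin n → Bool} → (∀ i → f i ≡ g i) → card f ≡ card g
card-cong {zero}          f≡g = refl
card-cong {suc n} {f} {g} f≡g rewrite f≡g zero =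
  cong (if g zero then suc else λ m → m) (card-cong (λ i → f≡g (suc i)))

card-false : ∀ n → card {n} (λ _ → false) ≡ 0
card-false zero    = refl
card-false (suc n) = card-false n

card-true : ∀ n → card {n} (λ _ → true) ≡ n
card-true zero    = refl
card-true (suc n) = cong suc (card-true n)

card-pos : ∀ {n} (f : Fin n → Bool) w → f w ≡ true → 0 < card f
card-pos f zero fw rewrite fw = s≤s z≤n
card-pos f (suc w) fw with f zero
... | true  = s≤s z≤n
... | false = card-pos (λ i → f (suc i)) w fw

card-pos⁻¹ : ∀ {n} (f : Fin n → Bool) → 0 < card f → ∃ λ w → f w ≡ true
card-pos⁻¹ {suc n} f pos with f zero in f0
... | true  = zero , f0
... | false with card-pos⁻¹ (λ i → f (suc i)) pos
...   | w , fw = suc w , fw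

card-∩+∖ : ∀ {n} (f g : Fin n → Bool) → card (f ∩ g) + card (f ∖ g) ≡ card f
card-∩+∖ {zero}  f g = refl
card-∩+∖ {suc n} f g with f zero | g zero
... | true  | true  = cong suc (card-∩+∖ (λ i → f (suc i)) (λ i → g (suc i)))
... | true  | false = trans (+-suc _ _) (cong suc (card-∩+∖ (λ i → f (suc i)) (λ i → g (suc i))))
... | false | true  = card-∩+∖ (λ i → f (suc i)) (λ i → g (suc i))
... | false | false = card-∩+∖ (λ i → f (suc i)) (λ i → g (suc i))

card-⊆ : ∀ {n} {f g : Fin n → Bool} → f ⊆ᵇ g → card f + card (g ∖ f) ≡ card g
card-⊆ {f = f} {g} f⊆g = trans (cong (_+ card (g ∖ f)) (card-cong f≡g∧f)) (card-∩+∖ g f)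
  where
  f≡g∧f : ∀ w → f w ≡ g w ∧ f w
  f≡g∧f w = bool-ext (λ fw → ∧-true (f⊆g w fw) fw) ∧-trueʳ

card-mono-< : ∀ {n} {f g : Fin n → Bool} → f ⊆ᵇ g → ∀ w → g w ≡ true → f w ≡ false → card f < card g
card-mono-< {f = f} {g} f⊆g w gw fw = begin-strict
  card f                                ≡⟨ +-identityʳ (card f) ⟨
  card f + 0                            <⟨ +-monoʳ-< (card f) (card-pos _ w (∧-true gw (not-false fw))) ⟩
  card f + card (g ∖ f)                 ≡⟨ card-⊆ f⊆g ⟩
  card g                                ∎
  where open ≤-Reasoning

card-lookup : ∀ {n} (S : Subset n) → ∣ S ∣ ≡ card (lookup S)
card-lookup []          = refl
card-lookup (true ∷ S)  = cong suc (card-lookup S)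
card-lookup (false ∷ S) = card-lookup S

card-tabulate : ∀ {n} (f : Fin n → Bool) → ∣ tabulate f ∣ ≡ card f
card-tabulate f = trans (card-lookup (tabulate f)) (card-cong (lookup∘tabulate f))

card-insert : ∀ {n} (u : Fin n) (S : Subset n) → lookup S u ≡ false →
  card (lookup (S [ u ]≔ inside)) ≡ suc (card (lookup S))
card-insert zero    (_ ∷ S)     Su rewrite Su = refl
card-insert (suc u) (true ∷ S)  Su = cong suc (card-insert u S Su)
card-insert (suc u) (false ∷ S) Su = card-insert u S Su

sum-≤-card* : ∀ {n} (D : Fin n → Bool) (g : Fin n → ℕ) B →
  (∀ u → D u ≡ true → g u ≤ B) → (∀ u → D u ≡ false → g u ≡ 0) → sum g ≤ card D * B
sum-≤-card* {zero}  D g B g≤B g≡0 = z≤n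
sum-≤-card* {suc n} D g B g≤B g≡0 with D zero in D0
... | true  = +-mono-≤ (g≤B zero D0) (sum-≤-card* _ _ B (λ u → g≤B (suc u)) (λ u → g≡0 (suc u)))
... | false rewrite g≡0 zero D0 = sum-≤-card* _ _ B (λ u → g≤B (suc u)) (λ u → g≡0 (suc u))

sum-≡-card* : ∀ {n} (D : Fin n → Bool) (g : Fin n → ℕ) B →
  (∀ u → D u ≡ true → g u ≡ B) → (∀ u → D u ≡ false → g u ≡ 0) → sum g ≡ card D * B
sum-≡-card* {zero}  D g B g≡B g≡0 = refl
sum-≡-card* {suc n} D g B g≡B g≡0 with D zero in D0
... | true  = cong₂ _+_ (g≡B zero D0) (sum-≡-card* _ _ B (λ u → g≡B (suc u)) (λ u → g≡0 (suc u)))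
... | false rewrite g≡0 zero D0 = sum-≡-card* _ _ B (λ u → g≡B (suc u)) (λ u → g≡0 (suc u))

+-≤-≡ : ∀ {a b c d} → a ≤ c → b ≤ d → a + b ≡ c + d → a ≡ c × b ≡ d
+-≤-≡ {a} {b} {c} {d} a≤c b≤d eq with m≤n⇒m<n∨m≡n a≤c
... | inj₂ refl = refl , +-cancelˡ-≡ a b d eq
... | inj₁ a<c  = ⊥-elim (<-irrefl eq (+-mono-<-≤ a<c b≤d))

sum-≡-card*⁻¹ : ∀ {n} (D : Fin n → Bool) (g : Fin n → ℕ) B →
  (∀ u → D u ≡ true → g u ≤ B) → (∀ u → D u ≡ false → g u ≡ 0) → sum g ≡ card D * B →
  ∀ u → D u ≡ true → g u ≡ B
sum-≡-card*⁻¹ {suc n} D g B g≤B g≡0 eq u Du with D zero in D0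
... | true  with +-≤-≡ (g≤B zero D0) (sum-≤-card* _ _ B (λ u → g≤B (suc u)) (λ u → g≡0 (suc u))) eq
...   | head≡ , tail≡ = case u Du
  where
  case : ∀ u → D u ≡ true → g u ≡ B
  case zero    _  = head≡
  case (suc u) Du = sum-≡-card*⁻¹ _ _ B (λ u → g≤B (suc u)) (λ u → g≡0 (suc u)) tail≡ u Du
sum-≡-card*⁻¹ {suc n} D g B g≤B g≡0 eq zero    Du | false = ⊥-elim (true≢false Du D0)
sum-≡-card*⁻¹ {suc n} D g B g≤B g≡0 eq (suc u) Du | false rewrite g≡0 zero D0 =
  sum-≡-card*⁻¹ _ _ B (λ u → g≤B (suc u)) (λ u → g≡0 (suc u)) eq u Du

argmin : ∀ {n} (A : Fin n → Bool) (f : Fin n → ℕ) w → A w ≡ true →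
  ∃ λ v → A v ≡ true × (∀ u → A u ≡ true → f v ≤ f u)
argmin {suc n} A f w Aw with any? (λ i → A (suc i) ≟ᵇ true)
... | no none = zero , only-zero w Aw , λ { zero _ → ≤-refl ; (suc u) Au → ⊥-elim (none (u , Au)) }
  where
  only-zero : ∀ w → A w ≡ true → A zero ≡ true
  only-zero zero    Aw = Aw
  only-zero (suc w) Aw = ⊥-elim (none (w , Aw))
... | yes (j , Aj) with argmin (λ i → A (suc i)) (λ i → f (suc i)) j Aj
...   | v , Av , min with true⊎false (A zero) | f zero ≤? f (suc v)
...     | inj₁ A0 | yes f0≤ = zero , A0 , λ where
  zero    _  → ≤-refl
  (suc u) Au → ≤-trans f0≤ (min u Au)
...     | inj₁ A0 | no  f0≰ = suc v , Av , λ where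
  zero    _  → <⇒≤ (≰⇒> f0≰)
  (suc u) Au → min u Au
...     | inj₂ A0 | _       = suc v , Av , λ where
  zero    A0′ → ⊥-elim (true≢false A0′ A0)
  (suc u) Au  → min u Au

countSubsets-false : ∀ n → countSubsets {n} (λ _ → false) ≡ 0
countSubsets-false zero    = refl
countSubsets-false (suc n) = cong₂ _+_ (countSubsets-false n) (countSubsets-false n)

countSubsets-cong : ∀ {n} {p q : Subset n → Bool} → (∀ S → p S ≡ q S) → countSubsets p ≡ countSubsets q
countSubsets-cong {zero}  p≡q = cong (λ b → countSubsets {0} (λ _ → b)) (p≡q [])
countSubsets-cong {suc n} p≡q =
  cong₂ _+_ (countSubsets-cong (λ S → p≡q (inside ∷ S))) (countSubsets-cong (λ S → p≡q (outside ∷ S)))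

countSubsets-pos : ∀ {n} (p : Subset n → Bool) S → p S ≡ true → 0 < countSubsets p
countSubsets-pos p [] pS rewrite pS = s≤s z≤n
countSubsets-pos p (true ∷ S) pS =
  ≤-trans (countSubsets-pos (λ S → p (inside ∷ S)) S pS) (m≤m+n _ _)
countSubsets-pos p (false ∷ S) pS =
  ≤-trans (countSubsets-pos (λ S → p (outside ∷ S)) S pS) (m≤n+m _ _)

countSubsets≡0 : ∀ {n} (p : Subset n → Bool) → countSubsets p ≡ 0 → ∀ S → p S ≢ true
countSubsets≡0 p p≡0 S pS = <-irrefl (sym p≡0) (countSubsets-pos p S pS)

countSubsets-∨+∧ : ∀ {n} (p q : Subset n → Bool) →
  countSubsets (λ S → p S ∨ q S) + countSubsets (λ S → p S ∧ q S) ≡ countSubsets p + countSubsets q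
countSubsets-∨+∧ {zero} p q with p [] | q []
... | true  | true  = refl
... | true  | false = refl
... | false | true  = refl
... | false | false = refl
countSubsets-∨+∧ {suc n} p q = begin
  (∨₁ + ∨₀) + (∧₁ + ∧₀)  ≡⟨ interchange ∨₁ ∨₀ ∧₁ ∧₀ ⟩
  (∨₁ + ∧₁) + (∨₀ + ∧₀)  ≡⟨ cong₂ _+_ (countSubsets-∨+∧ (λ S → p (inside ∷ S)) (λ S → q (inside ∷ S)))
                                    (countSubsets-∨+∧ (λ S → p (outside ∷ S)) (λ S → q (outside ∷ S))) ⟩
  (p₁ + q₁) + (p₀ + q₀)  ≡⟨ interchange p₁ q₁ p₀ q₀ ⟩
  (p₁ + p₀) + (q₁ + q₀)  ∎
  where
  open ≡-Reasoning
  interchange : ∀ a b c d → (a + b) + (c + d) ≡ (a + c) + (b + d)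
  interchange = solve-∀
  ∨₁ = countSubsets (λ S → p (inside ∷ S) ∨ q (inside ∷ S))
  ∨₀ = countSubsets (λ S → p (outside ∷ S) ∨ q (outside ∷ S))
  ∧₁ = countSubsets (λ S → p (inside ∷ S) ∧ q (inside ∷ S))
  ∧₀ = countSubsets (λ S → p (outside ∷ S) ∧ q (outside ∷ S))
  p₁ = countSubsets (λ S → p (inside ∷ S))
  p₀ = countSubsets (λ S → p (outside ∷ S))
  q₁ = countSubsets (λ S → q (inside ∷ S))
  q₀ = countSubsets (λ S → q (outside ∷ S))

countSubsets-∨ : ∀ {n} (p q : Subset n → Bool) →
  countSubsets (λ S → p S ∨ q S) ≤ countSubsets p + countSubsets q
countSubsets-∨ p q = ≤-trans (m≤m+n _ _) (≤-reflexive (countSubsets-∨+∧ p q))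

countSubsets-∈ : ∀ {n} (u : Fin n) (p : Subset n → Bool) →
  countSubsets (λ S → lookup S u ∧ p S) ≡ countSubsets (λ T → not (lookup T u) ∧ p (T [ u ]≔ inside))
countSubsets-∈ {suc n} zero p = begin
  countSubsets (λ S → p (inside ∷ S)) + countSubsets {n} (λ _ → false)
    ≡⟨ cong (countSubsets (λ S → p (inside ∷ S)) +_) (countSubsets-false n) ⟩
  countSubsets (λ S → p (inside ∷ S)) + 0
    ≡⟨ +-comm _ 0 ⟩
  0 + countSubsets (λ S → p (inside ∷ S))
    ≡⟨ cong (_+ countSubsets (λ S → p (inside ∷ S))) (countSubsets-false n) ⟨
  countSubsets {n} (λ _ → false) + countSubsets (λ S → p (inside ∷ S)) ∎
  where open ≡-Reasoning
countSubsets-∈ {suc n} (suc u) p =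
  cong₂ _+_ (countSubsets-∈ u (λ S → p (inside ∷ S))) (countSubsets-∈ u (λ S → p (outside ∷ S)))

isEmpty : ∀ {n} → Subset n → Bool
isEmpty []      = true
isEmpty (b ∷ S) = not b ∧ isEmpty S

countSubsets-isEmpty : ∀ n → countSubsets {n} isEmpty ≡ 1
countSubsets-isEmpty zero    = refl
countSubsets-isEmpty (suc n) = cong₂ _+_ (countSubsets-false n) (countSubsets-isEmpty n)

isEmpty⇒lookup≡false : ∀ {n} (S : Subset n) → isEmpty S ≡ true → ∀ w → lookup S w ≡ false
isEmpty⇒lookup≡false (false ∷ S) _ zero    = refl
isEmpty⇒lookup≡false (false ∷ S) e (suc w) = isEmpty⇒lookup≡false S e w

lookup≡false⇒isEmpty : ∀ {n} (S : Subset n) → (∀ w → lookup S w ≡ false) → isEmpty S ≡ true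
lookup≡false⇒isEmpty []      _     = refl
lookup≡false⇒isEmpty (b ∷ S) empty rewrite empty zero = lookup≡false⇒isEmpty S (λ w → empty (suc w))

⋁ : ∀ {k} → (Fin k → Bool) → Bool
⋁ {zero}  f = false
⋁ {suc k} f = f zero ∨ ⋁ (λ i → f (suc i))

⋁-intro : ∀ {k} (f : Fin k → Bool) i → f i ≡ true → ⋁ f ≡ true
⋁-intro f zero    fi rewrite fi = refl
⋁-intro f (suc i) fi with f zero
... | true  = refl
... | false = ⋁-intro (λ i → f (suc i)) i fi

⋁-elim : ∀ {k} (f : Fin k → Bool) → ⋁ f ≡ true → ∃ λ i → f i ≡ true
⋁-elim {suc k} f ⋁f with f zero in f0
... | true  = zero , f0
... | false with ⋁-elim (λ i → f (suc i)) ⋁f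
...   | i , fi = suc i , fi

module _ {n : ℕ} where

  PairwiseDisjoint : ∀ {k} → (Fin k → Subset n → Bool) → Set
  PairwiseDisjoint Q = ∀ S i j → i ≢ j → Q i S ≡ true → Q j S ≡ true → ⊥

  countSubsets-⋁ : ∀ {k} (Q : Fin k → Subset n → Bool) →
    countSubsets (λ S → ⋁ (λ i → Q i S)) ≤ sum (λ i → countSubsets (Q i))
  countSubsets-⋁ {zero}  Q = ≤-reflexive (countSubsets-false n)
  countSubsets-⋁ {suc k} Q = ≤-trans (countSubsets-∨ (Q zero) (λ S → ⋁ (λ i → Q (suc i) S)))
                                     (+-monoʳ-≤ (countSubsets (Q zero)) (countSubsets-⋁ (λ i → Q (suc i))))

  countSubsets-⋁-tight : ∀ {k} (Q : Fin k → Subset n → Bool) →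
    countSubsets (λ S → ⋁ (λ i → Q i S)) ≡ sum (λ i → countSubsets (Q i)) → PairwiseDisjoint Q
  countSubsets-⋁-tight {suc k} Q eq S = disjoint
    where
    head = countSubsets (Q zero)
    rest = countSubsets (λ S → ⋁ (λ i → Q (suc i) S))
    both = countSubsets (λ S → Q zero S ∧ ⋁ (λ i → Q (suc i) S))
    either = countSubsets (λ S → Q zero S ∨ ⋁ (λ i → Q (suc i) S))
    incl-excl : either + both ≡ head + rest
    incl-excl = countSubsets-∨+∧ (Q zero) (λ S → ⋁ (λ i → Q (suc i) S))
    rest≤ : rest ≤ sum (λ i → countSubsets (Q (suc i)))
    rest≤ = countSubsets-⋁ (λ i → Q (suc i))
    both≡0 : both ≡ 0
    both≡0 = n≤0⇒n≡0 (+-cancelˡ-≤ either both 0 (begin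
      either + both                                       ≡⟨ incl-excl ⟩
      head + rest                                         ≤⟨ +-monoʳ-≤ head rest≤ ⟩
      head + sum (λ i → countSubsets (Q (suc i)))         ≡⟨ eq ⟨
      either                                              ≡⟨ +-identityʳ either ⟨
      either + 0                                          ∎))
      where open ≤-Reasoning
    rest≡ : rest ≡ sum (λ i → countSubsets (Q (suc i)))
    rest≡ = ≤-antisym rest≤ (+-cancelˡ-≤ head _ _ (begin
      head + sum (λ i → countSubsets (Q (suc i)))         ≡⟨ eq ⟨
      either                                              ≤⟨ m≤m+n either both ⟩
      either + both                                       ≡⟨ incl-excl ⟩
      head + rest                                         ∎))
      where open ≤-Reasoning
    disjoint : ∀ i j → i ≢ j → Q i S ≡ true → Q j S ≡ true → ⊥
    disjoint zero    zero    i≢j _   _   = i≢j refl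
    disjoint zero    (suc j) _   Qi  Qj  =
      countSubsets≡0 _ both≡0 S (∧-true Qi (⋁-intro (λ i → Q (suc i) S) j Qj))
    disjoint (suc i) zero    _   Qi  Qj  =
      countSubsets≡0 _ both≡0 S (∧-true Qj (⋁-intro (λ i → Q (suc i) S) i Qi))
    disjoint (suc i) (suc j) i≢j Qi  Qj  =
      countSubsets-⋁-tight (λ i → Q (suc i)) rest≡ S i j (λ i≡j → i≢j (cong suc i≡j)) Qi Qj

  countSubsets-⋁-disjoint : ∀ {k} (Q : Fin k → Subset n → Bool) → PairwiseDisjoint Q →
    countSubsets (λ S → ⋁ (λ i → Q i S)) ≡ sum (λ i → countSubsets (Q i))
  countSubsets-⋁-disjoint {zero}  Q _        = countSubsets-false n
  countSubsets-⋁-disjoint {suc k} Q disjoint = begin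
    either                ≡⟨ +-identityʳ either ⟨
    either + 0            ≡⟨ cong (either +_) both≡0 ⟨
    either + both         ≡⟨ countSubsets-∨+∧ (Q zero) (λ S → ⋁ (λ i → Q (suc i) S)) ⟩
    countSubsets (Q zero) + countSubsets (λ S → ⋁ (λ i → Q (suc i) S))
      ≡⟨ cong (countSubsets (Q zero) +_) (countSubsets-⋁-disjoint (λ i → Q (suc i))
                (λ S i j i≢j → disjoint S (suc i) (suc j) (λ { refl → i≢j refl }))) ⟩
    countSubsets (Q zero) + sum (λ i → countSubsets (Q (suc i))) ∎
    where
    open ≡-Reasoning
    either = countSubsets (λ S → Q zero S ∨ ⋁ (λ i → Q (suc i) S))
    both = countSubsets (λ S → Q zero S ∧ ⋁ (λ i → Q (suc i) S))
    both≡0 : both ≡ 0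
    both≡0 = trans (countSubsets-cong never) (countSubsets-false n)
      where
      never : ∀ S → (Q zero S ∧ ⋁ (λ i → Q (suc i) S)) ≡ false
      never S = ≢true⇒≡false λ both → let (i , Qi) = ⋁-elim (λ i → Q (suc i) S) (∧-trueʳ both) in
                  disjoint S zero (suc i) (λ ()) (∧-trueˡ both) Qi

-- The inequality j (3/4)^j ≤ 81/64 and the bound f(m, k)

Is3or4 : ℕ → Set
Is3or4 j = j ≡ 3 ⊎ j ≡ 4

4+n*[64*3^n]≤81*4^n : ∀ t → (4 + t) * (64 * 3 ^ (4 + t)) ≤ 81 * 4 ^ (4 + t)
5+n*[64*3^n]<81*4^n : ∀ t → (5 + t) * (64 * 3 ^ (5 + t)) < 81 * 4 ^ (5 + t)

4+n*[64*3^n]≤81*4^n zero    = ≤-refl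
4+n*[64*3^n]≤81*4^n (suc t) = <⇒≤ (5+n*[64*3^n]<81*4^n t)

5+n*[64*3^n]<81*4^n t = begin-strict
  (5 + t) * (64 * 3 ^ (5 + t))  ≡⟨ regroup (5 + t) (3 ^ (4 + t)) ⟩
  (3 * (5 + t)) * X             <⟨ *-monoˡ-< X {{>-nonZero X>0}} 3[5+t]<4[4+t] ⟩
  (4 * (4 + t)) * X             ≡⟨ *-assoc 4 (4 + t) X ⟩
  4 * ((4 + t) * X)             ≤⟨ *-monoʳ-≤ 4 (4+n*[64*3^n]≤81*4^n t) ⟩
  4 * (81 * 4 ^ (4 + t))        ≡⟨ *-comm-middle 4 81 (4 ^ (4 + t)) ⟩
  81 * 4 ^ (5 + t)              ∎
  where
  open ≤-Reasoning
  X = 64 * 3 ^ (4 + t)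
  X>0 : 0 < X
  X>0 = *-monoʳ-< 64 (m^n>0 3 (4 + t))
  3[5+t]<4[4+t] : 3 * (5 + t) < 4 * (4 + t)
  3[5+t]<4[4+t] = subst₂ _≤_ (lhs t) (rhs t) (+-monoʳ-≤ 16 (*-monoˡ-≤ t (n≤1+n 3)))
    where
    lhs : ∀ t → 16 + 3 * t ≡ suc (3 * (5 + t))
    lhs = solve-∀
    rhs : ∀ t → 16 + 4 * t ≡ 4 * (4 + t)
    rhs = solve-∀
  regroup : ∀ a b → a * (64 * (3 * b)) ≡ (3 * a) * (64 * b)
  regroup = solve-∀
  *-comm-middle : ∀ a b c → a * (b * c) ≡ b * (a * c)
  *-comm-middle = solve-∀

n*[64*3^n]≤81*4^n : ∀ n → n * (64 * 3 ^ n) ≤ 81 * 4 ^ n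
n*[64*3^n]≤81*4^n 0 = z≤n
n*[64*3^n]≤81*4^n 1 = toWitness {a? = 192 ≤? 324} _
n*[64*3^n]≤81*4^n 2 = toWitness {a? = 1152 ≤? 1296} _
n*[64*3^n]≤81*4^n 3 = ≤-refl
n*[64*3^n]≤81*4^n (suc (suc (suc (suc t)))) = 4+n*[64*3^n]≤81*4^n t

n*[64*3^n]≡81*4^n⇒n≡3⊎n≡4 : ∀ n → n * (64 * 3 ^ n) ≡ 81 * 4 ^ n → Is3or4 n
n*[64*3^n]≡81*4^n⇒n≡3⊎n≡4 0 ()
n*[64*3^n]≡81*4^n⇒n≡3⊎n≡4 1 ()
n*[64*3^n]≡81*4^n⇒n≡3⊎n≡4 2 ()
n*[64*3^n]≡81*4^n⇒n≡3⊎n≡4 3 _ = inj₁ refl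
n*[64*3^n]≡81*4^n⇒n≡3⊎n≡4 4 _ = inj₂ refl
n*[64*3^n]≡81*4^n⇒n≡3⊎n≡4 (suc (suc (suc (suc (suc t))))) eq =
  ⊥-elim (<-irrefl eq (5+n*[64*3^n]<81*4^n t))

-- scaled x m k ≤ bound m k is x ≤ f(m, k) = 3^(4k−m) 4^(m−3k) with the denominators cleared
scaled : ℕ → ℕ → ℕ → ℕ
scaled x m k = x * 3 ^ m * 4 ^ (3 * k)

bound : ℕ → ℕ → ℕ
bound m k = 3 ^ (4 * k) * 4 ^ m

bound>0 : ∀ m k → 0 < bound m k
bound>0 m k = *-mono-≤ (m^n>0 3 (4 * k)) (m^n>0 4 m)

scaled-+-suc : ∀ x μ r k → scaled x (μ + r) (suc k) ≡ (64 * 3 ^ μ) * scaled x r k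
scaled-+-suc x μ r k = begin
  x * 3 ^ (μ + r) * 4 ^ (3 * suc k)           ≡⟨ cong₂ (λ a b → x * a * 4 ^ b) (^-distribˡ-+-* 3 μ r) (*-suc 3 k) ⟩
  x * (3 ^ μ * 3 ^ r) * 4 ^ (3 + 3 * k)       ≡⟨ cong (x * (3 ^ μ * 3 ^ r) *_) (^-distribˡ-+-* 4 3 (3 * k)) ⟩
  x * (3 ^ μ * 3 ^ r) * (64 * 4 ^ (3 * k))    ≡⟨ regroup x (3 ^ μ) (3 ^ r) (4 ^ (3 * k)) ⟩
  (64 * 3 ^ μ) * (x * 3 ^ r * 4 ^ (3 * k))    ∎
  where
  open ≡-Reasoning
  regroup : ∀ x a b c → x * (a * b) * (64 * c) ≡ (64 * a) * (x * b * c)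
  regroup = solve-∀

bound-+-suc : ∀ μ r k → bound (μ + r) (suc k) ≡ (81 * 4 ^ μ) * bound r k
bound-+-suc μ r k = begin
  3 ^ (4 * suc k) * 4 ^ (μ + r)               ≡⟨ cong₂ (λ a b → 3 ^ a * b) (*-suc 4 k) (^-distribˡ-+-* 4 μ r) ⟩
  3 ^ (4 + 4 * k) * (4 ^ μ * 4 ^ r)           ≡⟨ cong (_* (4 ^ μ * 4 ^ r)) (^-distribˡ-+-* 3 4 (4 * k)) ⟩
  (81 * 3 ^ (4 * k)) * (4 ^ μ * 4 ^ r)        ≡⟨ regroup (3 ^ (4 * k)) (4 ^ μ) (4 ^ r) ⟩
  (81 * 4 ^ μ) * (3 ^ (4 * k) * 4 ^ r)        ∎
  where
  open ≡-Reasoning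
  regroup : ∀ a b c → (81 * a) * (b * c) ≡ (81 * b) * (a * c)
  regroup = solve-∀

scaled-monoˡ-≤ : ∀ {x y} m k → x ≤ y → scaled x m k ≤ scaled y m k
scaled-monoˡ-≤ m k x≤y = *-monoˡ-≤ (4 ^ (3 * k)) (*-monoˡ-≤ (3 ^ m) x≤y)

scaled-cancelˡ-≡ : ∀ {x y} m k → scaled x m k ≡ scaled y m k → x ≡ y
scaled-cancelˡ-≡ {x} {y} m k eq =
  *-cancelʳ-≡ x y (3 ^ m) {{m^n≢0 3 m}} (*-cancelʳ-≡ _ _ (4 ^ (3 * k)) {{m^n≢0 4 (3 * k)}} eq)

scaled-sum : ∀ {j} (xs : Fin j → ℕ) m k → scaled (sum xs) m k ≡ sum (λ i → scaled (xs i) m k)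
scaled-sum xs m k = begin
  sum xs * 3 ^ m * 4 ^ (3 * k)                   ≡⟨ cong (_* 4 ^ (3 * k)) (*-distribʳ-sum (3 ^ m) xs) ⟩
  sum (λ i → xs i * 3 ^ m) * 4 ^ (3 * k)         ≡⟨ *-distribʳ-sum (4 ^ (3 * k)) (λ i → xs i * 3 ^ m) ⟩
  sum (λ i → xs i * 3 ^ m * 4 ^ (3 * k))         ∎
  where open ≡-Reasoning

*-≤-≡ : ∀ {a b c d} → a ≤ b → c ≤ d → 0 < b → 0 < d → a * c ≡ b * d → a ≡ b × c ≡ d
*-≤-≡ {a} {b} {c} {d} a≤b c≤d b>0 d>0 eq = a≡b , c≡d
  where
  ac≤bc : a * c ≤ b * c
  ac≤bc = *-monoˡ-≤ c a≤b
  bc≤bd : b * c ≤ b * d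
  bc≤bd = *-monoʳ-≤ b c≤d
  c≡d : c ≡ d
  c≡d = *-cancelˡ-≡ c d b {{>-nonZero b>0}} (≤-antisym bc≤bd (subst (_≤ b * c) eq ac≤bc))
  a≡b : a ≡ b
  a≡b = *-cancelʳ-≡ a b d {{>-nonZero d>0}} (subst (λ c → a * c ≡ b * d) c≡d eq)

scaled-step-≤ : ∀ d μ r k x → d ≤ μ → scaled x r k ≤ bound r k →
  d * scaled x (μ + r) (suc k) ≤ bound (μ + r) (suc k)
scaled-step-≤ d μ r k x d≤μ ih = begin
  d * scaled x (μ + r) (suc k)       ≡⟨ cong (d *_) (scaled-+-suc x μ r k) ⟩
  d * ((64 * 3 ^ μ) * scaled x r k)  ≡⟨ *-assoc d (64 * 3 ^ μ) (scaled x r k) ⟨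
  (d * (64 * 3 ^ μ)) * scaled x r k  ≤⟨ *-mono-≤ d[64*3^μ]≤81*4^μ ih ⟩
  (81 * 4 ^ μ) * bound r k           ≡⟨ bound-+-suc μ r k ⟨
  bound (μ + r) (suc k)              ∎
  where
  open ≤-Reasoning
  d[64*3^μ]≤81*4^μ : d * (64 * 3 ^ μ) ≤ 81 * 4 ^ μ
  d[64*3^μ]≤81*4^μ = ≤-trans (*-monoˡ-≤ (64 * 3 ^ μ) d≤μ) (n*[64*3^n]≤81*4^n μ)

scaled-step-≡⁻¹ : ∀ d μ r k x → d ≤ μ → scaled x r k ≤ bound r k →
  d * scaled x (μ + r) (suc k) ≡ bound (μ + r) (suc k) →
  d ≡ μ × Is3or4 μ × scaled x r k ≡ bound r k
scaled-step-≡⁻¹ d μ r k x d≤μ ih eq = d≡μ , n*[64*3^n]≡81*4^n⇒n≡3⊎n≡4 μ μ-tight , proj₂ factors-tight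
  where
  X = 64 * 3 ^ μ
  dX≤μX : d * X ≤ μ * X
  dX≤μX = *-monoˡ-≤ X d≤μ
  factors-tight : d * X ≡ 81 * 4 ^ μ × scaled x r k ≡ bound r k
  factors-tight = *-≤-≡ (≤-trans dX≤μX (n*[64*3^n]≤81*4^n μ)) ih (*-monoʳ-< 81 (m^n>0 4 μ)) (bound>0 r k) (begin
    d * X * scaled x r k          ≡⟨ *-assoc d X (scaled x r k) ⟩
    d * (X * scaled x r k)        ≡⟨ cong (d *_) (scaled-+-suc x μ r k) ⟨
    d * scaled x (μ + r) (suc k)  ≡⟨ eq ⟩
    bound (μ + r) (suc k)         ≡⟨ bound-+-suc μ r k ⟩
    81 * 4 ^ μ * bound r k        ∎)
    where open ≡-Reasoning
  μ-tight : μ * X ≡ 81 * 4 ^ μ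
  μ-tight = ≤-antisym (n*[64*3^n]≤81*4^n μ) (subst (_≤ μ * X) (proj₁ factors-tight) dX≤μX)
  d≡μ : d ≡ μ
  d≡μ = *-cancelʳ-≡ d μ X {{>-nonZero (*-monoʳ-< 64 (m^n>0 3 μ))}} (trans (proj₁ factors-tight) (sym μ-tight))

scaled-step-≡ : ∀ d r k x → Is3or4 d → scaled x r k ≡ bound r k →
  d * scaled x (d + r) (suc k) ≡ bound (d + r) (suc k)
scaled-step-≡ d r k x d∈34 ih = begin
  d * scaled x (d + r) (suc k)       ≡⟨ cong (d *_) (scaled-+-suc x d r k) ⟩
  d * ((64 * 3 ^ d) * scaled x r k)  ≡⟨ *-assoc d (64 * 3 ^ d) (scaled x r k) ⟨
  (d * (64 * 3 ^ d)) * scaled x r k  ≡⟨ cong₂ _*_ (extremal d∈34) ih ⟩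
  (81 * 4 ^ d) * bound r k           ≡⟨ bound-+-suc d r k ⟨
  bound (d + r) (suc k)              ∎
  where
  open ≡-Reasoning
  extremal : Is3or4 d → d * (64 * 3 ^ d) ≡ 81 * 4 ^ d
  extremal (inj₁ refl) = refl
  extremal (inj₂ refl) = refl

scaled-1-0<bound-0 : ∀ k → scaled 1 0 (suc k) < bound 0 (suc k)
scaled-1-0<bound-0 k = begin-strict
  1 * 4 ^ (3 * suc k)      ≡⟨ *-identityˡ _ ⟩
  4 ^ (3 * suc k)          ≡⟨ ^-*-assoc 4 3 (suc k) ⟨
  64 ^ suc k               <⟨ ^-monoˡ-< (suc k) (toWitness {a? = 65 ≤? 81} _) ⟩
  81 ^ suc k               ≡⟨ ^-*-assoc 3 4 (suc k) ⟩
  3 ^ (4 * suc k)          ≡⟨ *-identityʳ _ ⟨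
  3 ^ (4 * suc k) * 1      ∎
  where open ≤-Reasoning

^-splitˡ : ∀ b m n → b ^ n ≡ b ^ (m ⊓ n) * b ^ (n ∸ m)
^-splitˡ b m n = trans (cong (b ^_) (sym (m⊓n+n∸m≡n m n))) (^-distribˡ-+-* b (m ⊓ n) (n ∸ m))

^-splitʳ : ∀ b m n → b ^ m ≡ b ^ (m ⊓ n) * b ^ (m ∸ n)
^-splitʳ b m n = trans (^-splitˡ b n m) (cong (λ j → b ^ j * b ^ (m ∸ n)) (⊓-comm n m))

module _ (x m k : ℕ) where

  private
    common : ℕ
    common = 3 ^ (m ⊓ (4 * k)) * 4 ^ (m ⊓ (3 * k))

    common>0 : 0 < common
    common>0 = *-mono-≤ (m^n>0 3 (m ⊓ (4 * k))) (m^n>0 4 (m ⊓ (3 * k)))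

    scaled≡ : scaled x m k ≡ common * (x * 3 ^ (m ∸ 4 * k) * 4 ^ (3 * k ∸ m))
    scaled≡ = begin
      x * 3 ^ m * 4 ^ (3 * k)
        ≡⟨ cong₂ (λ a b → x * a * b) (^-splitʳ 3 m (4 * k)) (^-splitˡ 4 m (3 * k)) ⟩
      x * (3 ^ (m ⊓ (4 * k)) * 3 ^ (m ∸ 4 * k)) * (4 ^ (m ⊓ (3 * k)) * 4 ^ (3 * k ∸ m))
        ≡⟨ regroup x (3 ^ (m ⊓ (4 * k))) (3 ^ (m ∸ 4 * k)) (4 ^ (m ⊓ (3 * k))) (4 ^ (3 * k ∸ m)) ⟩
      common * (x * 3 ^ (m ∸ 4 * k) * 4 ^ (3 * k ∸ m)) ∎
      where
      open ≡-Reasoning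
      regroup : ∀ x a b c d → x * (a * b) * (c * d) ≡ (a * c) * (x * b * d)
      regroup = solve-∀

    bound≡ : bound m k ≡ common * (3 ^ (4 * k ∸ m) * 4 ^ (m ∸ 3 * k))
    bound≡ = begin
      3 ^ (4 * k) * 4 ^ m
        ≡⟨ cong₂ _*_ (^-splitˡ 3 m (4 * k)) (^-splitʳ 4 m (3 * k)) ⟩
      (3 ^ (m ⊓ (4 * k)) * 3 ^ (4 * k ∸ m)) * (4 ^ (m ⊓ (3 * k)) * 4 ^ (m ∸ 3 * k))
        ≡⟨ regroup (3 ^ (m ⊓ (4 * k))) (3 ^ (4 * k ∸ m)) (4 ^ (m ⊓ (3 * k))) (4 ^ (m ∸ 3 * k)) ⟩
      common * (3 ^ (4 * k ∸ m) * 4 ^ (m ∸ 3 * k)) ∎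
      where
      open ≡-Reasoning
      regroup : ∀ a b c d → (a * b) * (c * d) ≡ (a * c) * (b * d)
      regroup = solve-∀

  scaled≤bound⇒ : scaled x m k ≤ bound m k →
    x * 3 ^ (m ∸ 4 * k) * 4 ^ (3 * k ∸ m) ≤ 3 ^ (4 * k ∸ m) * 4 ^ (m ∸ 3 * k)
  scaled≤bound⇒ le = *-cancelˡ-≤ common {{>-nonZero common>0}} (subst₂ _≤_ scaled≡ bound≡ le)

  scaled≡bound⇔ : scaled x m k ≡ bound m k ⇔
    (x * 3 ^ (m ∸ 4 * k) * 4 ^ (3 * k ∸ m) ≡ 3 ^ (4 * k ∸ m) * 4 ^ (m ∸ 3 * k))
  scaled≡bound⇔ = mk⇔
    (λ eq → *-cancelˡ-≡ _ _ common {{>-nonZero common>0}} (trans (sym scaled≡) (trans eq bound≡)))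
    (λ eq → trans scaled≡ (trans (cong (common *_) eq) (sym bound≡)))

-- Maximal independent sets of induced subgraphs

module _ {n : ℕ} (G : Graph n) where

  VertexSet : Set
  VertexSet = Fin n → Bool

  IsIndependent : VertexSet → Set
  IsIndependent s = ∀ u w → s u ≡ true → s w ≡ true → ¬ Adj G u w

  Dominates : VertexSet → VertexSet → Set
  Dominates s A = ∀ w → A w ≡ true → s w ≡ false → ∃ λ u → s u ≡ true × Adj G u w

  -- s is a maximal independent set of G[A], i.e. a dominating independent subset of A
  IsMIS : VertexSet → VertexSet → Set
  IsMIS A s = s ⊆ᵇ A × IsIndependent s × Dominates s A

  isMIS? : ∀ A s → Dec (IsMIS A s)
  isMIS? A s =
    (all? λ w → (s w ≟ᵇ true) →-dec (A w ≟ᵇ true)) ×-dec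
    (all? λ u → all? λ w → (s u ≟ᵇ true) →-dec ((s w ≟ᵇ true) →-dec ¬? (adj? G u w))) ×-dec
    (all? λ w → (A w ≟ᵇ true) →-dec ((s w ≟ᵇ false) →-dec any? λ u → (s u ≟ᵇ true) ×-dec adj? G u w))

  isSmallMIS : VertexSet → ℕ → Subset n → Bool
  isSmallMIS A k S = does (isMIS? A (lookup S) ×-dec (card (lookup S) ≤? k))

  -- misCount A k = mis≤k(G[A]); like mis≤, it counts vectors S : Subset n
  misCount : VertexSet → ℕ → ℕ
  misCount A k = countSubsets (isSmallMIS A k)

  isSmallMIS⁻¹ : ∀ {A k} S → isSmallMIS A k S ≡ true → IsMIS A (lookup S) × card (lookup S) ≤ k
  isSmallMIS⁻¹ {A} {k} S = dec-true⁻¹ (isMIS? A (lookup S) ×-dec (card (lookup S) ≤? k))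

  isSmallMIS⁺ : ∀ {A k} S → IsMIS A (lookup S) → card (lookup S) ≤ k → isSmallMIS A k S ≡ true
  isSmallMIS⁺ {A} {k} S mis small = dec-true (isMIS? A (lookup S) ×-dec (card (lookup S) ≤? k)) (mis , small)

  IsMIS-cong : ∀ {A A' s} → (∀ w → A w ≡ A' w) → IsMIS A s → IsMIS A' s
  IsMIS-cong A≡A' (s⊆A , independent , dominates) =
    (λ w sw → trans (sym (A≡A' w)) (s⊆A w sw)) , independent , (λ w A'w → dominates w (trans (A≡A' w) A'w))

  misCount-cong : ∀ {A A'} k → (∀ w → A w ≡ A' w) → misCount A k ≡ misCount A' k
  misCount-cong {A} {A'} k A≡A' = countSubsets-cong λ S →
    does-⇔ (isMIS? A (lookup S) ×-dec (card (lookup S) ≤? k)) (isMIS? A' (lookup S) ×-dec (card (lookup S) ≤? k))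
      (λ (mis , small) → IsMIS-cong A≡A' mis , small)
      (λ (mis , small) → IsMIS-cong (λ w → sym (A≡A' w)) mis , small)

  N[_]? : ∀ u w → Dec (w ≡ u ⊎ Adj G u w)
  N[ u ]? w = (w ≟ᶠ u) ⊎-dec adj? G u w

  N[_] : Fin n → VertexSet
  N[ u ] w = does (N[ u ]? w)

  N[u]∋u : ∀ u → N[ u ] u ≡ true
  N[u]∋u u = dec-true (N[ u ]? u) (inj₁ refl)

  N[u]∋adj : ∀ {u w} → Adj G u w → N[ u ] w ≡ true
  N[u]∋adj {u} {w} uw = dec-true (N[ u ]? w) (inj₂ uw)

  N[u]∌ : ∀ {u w} → w ≢ u → ¬ Adj G u w → N[ u ] w ≡ false
  N[u]∌ {u} {w} w≢u ¬uw = dec-false (N[ u ]? w) λ { (inj₁ w≡u) → w≢u w≡u ; (inj₂ uw) → ¬uw uw }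

  N[u]∌⁻¹ : ∀ {u w} → N[ u ] w ≡ false → w ≢ u × ¬ Adj G u w
  N[u]∌⁻¹ {u} {w} N∌w = (λ w≡u → dec-false⁻¹ (N[ u ]? w) N∌w (inj₁ w≡u))
                      , (λ uw → dec-false⁻¹ (N[ u ]? w) N∌w (inj₂ uw))

  N[u]∋⁻¹ : ∀ {u w} → N[ u ] w ≡ true → w ≡ u ⊎ Adj G u w
  N[u]∋⁻¹ {u} {w} = dec-true⁻¹ (N[ u ]? w)

  IsMIS-delete : ∀ A u T → lookup T u ≡ false → IsMIS A (lookup (T [ u ]≔ inside)) →
    IsMIS (A ∖ N[ u ]) (lookup T)
  IsMIS-delete A u T Tu (T'⊆A , independent , dominates) = T⊆A∖N[u] , independent-T , dominates-T
    where
    T' = lookup (T [ u ]≔ inside)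
    ≢u : ∀ {w} → lookup T w ≡ true → w ≢ u
    ≢u Tw refl = true≢false Tw Tu
    T⊆T' : ∀ {w} → lookup T w ≡ true → T' w ≡ true
    T⊆T' Tw = trans (lookup-insert-≢ T (≢u Tw)) Tw
    T⊆A∖N[u] : lookup T ⊆ᵇ (A ∖ N[ u ])
    T⊆A∖N[u] w Tw =
      ∧-true (T'⊆A w (T⊆T' Tw)) (not-false (N[u]∌ (≢u Tw) (independent u w (lookup-insert T u) (T⊆T' Tw))))
    independent-T : IsIndependent (lookup T)
    independent-T a b Ta Tb = independent a b (T⊆T' Ta) (T⊆T' Tb)
    dominates-T : Dominates (lookup T) (A ∖ N[ u ])
    dominates-T w A∖N[u]w Tw with N[u]∌⁻¹ (not-true (∧-trueʳ {A w} A∖N[u]w))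
    ... | w≢u , ¬uw with dominates w (∧-trueˡ A∖N[u]w) (trans (lookup-insert-≢ T w≢u) Tw)
    ...   | y , T'y , yw with y ≟ᶠ u
    ...     | yes refl = ⊥-elim (¬uw yw)
    ...     | no  y≢u  = y , trans (sym (lookup-insert-≢ T y≢u)) T'y , yw

  IsMIS-insert : ∀ A u T → A u ≡ true → IsMIS (A ∖ N[ u ]) (lookup T) →
    lookup T u ≡ false × IsMIS A (lookup (T [ u ]≔ inside))
  IsMIS-insert A u T Au (T⊆A∖N[u] , independent , dominates) = Tu , T'⊆A , independent-T' , dominates-T'
    where
    T' = lookup (T [ u ]≔ inside)
    Tu : lookup T u ≡ false
    Tu = ≢true⇒≡false λ Tu → true≢false (∧-trueʳ {A u} (T⊆A∖N[u] u Tu)) (cong not (N[u]∋u u))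
    ¬adj-u : ∀ {y} → lookup T y ≡ true → ¬ Adj G u y
    ¬adj-u {y} Ty uy = true≢false (N[u]∋adj uy) (not-true (∧-trueʳ {A y} (T⊆A∖N[u] y Ty)))
    T'⊆A : T' ⊆ᵇ A
    T'⊆A y T'y with lookup-insert⁻¹ T u y T'y
    ... | inj₁ refl      = Au
    ... | inj₂ (_ , Ty)  = ∧-trueˡ (T⊆A∖N[u] y Ty)
    independent-T' : IsIndependent T'
    independent-T' a b T'a T'b with lookup-insert⁻¹ T u a T'a | lookup-insert⁻¹ T u b T'b
    ... | inj₁ refl      | inj₁ refl      = irrefl G
    ... | inj₁ refl      | inj₂ (_ , Tb)  = ¬adj-u Tb
    ... | inj₂ (_ , Ta)  | inj₁ refl      = λ ab → ¬adj-u Ta (Graph.sym G ab)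
    ... | inj₂ (_ , Ta)  | inj₂ (_ , Tb)  = independent a b Ta Tb
    dominates-T' : Dominates T' A
    dominates-T' w Aw T'w with w ≟ᶠ u
    ... | yes refl = ⊥-elim (true≢false (lookup-insert T u) T'w)
    ... | no  w≢u with N[ u ]? w
    ...   | yes (inj₁ w≡u) = ⊥-elim (w≢u w≡u)
    ...   | yes (inj₂ uw)  = u , lookup-insert T u , uw
    ...   | no  ¬N[u]w with dominates w (∧-true Aw (not-false (dec-false (N[ u ]? w) ¬N[u]w)))
                                      (trans (sym (lookup-insert-≢ T w≢u)) T'w)
    ...     | y , Ty , yw = y , trans (lookup-insert-≢ T (λ { refl → true≢false Ty Tu })) Ty , yw

  misCount-∋ : ∀ A u k → A u ≡ true →
    countSubsets (λ S → lookup S u ∧ isSmallMIS A (suc k) S) ≡ misCount (A ∖ N[ u ]) k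
  misCount-∋ A u k Au = trans (countSubsets-∈ u (isSmallMIS A (suc k))) (countSubsets-cong pointwise)
    where
    pointwise : ∀ T → not (lookup T u) ∧ isSmallMIS A (suc k) (T [ u ]≔ inside) ≡ isSmallMIS (A ∖ N[ u ]) k T
    pointwise T = bool-ext to from
      where
      T∪u = T [ u ]≔ inside
      to : not (lookup T u) ∧ isSmallMIS A (suc k) T∪u ≡ true → isSmallMIS (A ∖ N[ u ]) k T ≡ true
      to both with isSmallMIS⁻¹ T∪u (∧-trueʳ {not (lookup T u)} both)
      ... | mis , small = isSmallMIS⁺ T (IsMIS-delete A u T Tu mis)
                            (≤-pred (subst (_≤ suc k) (card-insert u T Tu) small))
        where Tu = not-true (∧-trueˡ both)
      from : isSmallMIS (A ∖ N[ u ]) k T ≡ true → not (lookup T u) ∧ isSmallMIS A (suc k) T∪u ≡ true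
      from small-T with isSmallMIS⁻¹ T small-T
      ... | mis , small with IsMIS-insert A u T Au mis
      ...   | Tu , mis' = ∧-true (not-false Tu)
                            (isSmallMIS⁺ T∪u mis' (subst (_≤ suc k) (sym (card-insert u T Tu)) (s≤s small)))

  -- Decompositions into copies of K₃ and K₄

  record IsK34Component (A C : VertexSet) : Set where
    field
      subset : C ⊆ᵇ A
      size   : Is3or4 (card C)
      clique : ∀ u w → C u ≡ true → C w ≡ true → u ≢ w → Adj G u w
      closed : ∀ u w → C u ≡ true → A w ≡ true → Adj G u w → C w ≡ true

  data K34Decomposition : VertexSet → ℕ → Set where
    []  : ∀ {A} → (∀ w → A w ≡ false) → K34Decomposition A 0
    _∷_ : ∀ {A C k} → IsK34Component A C → K34Decomposition (A ∖ C) k → K34Decomposition A (suc k)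

  IsK34Component-cong : ∀ {A A' C} → (∀ w → A w ≡ A' w) → IsK34Component A C → IsK34Component A' C
  IsK34Component-cong A≡A' component = record
    { subset = λ w Cw → trans (sym (A≡A' w)) (subset w Cw)
    ; size   = size
    ; clique = clique
    ; closed = λ u w Cu A'w → closed u w Cu (trans (A≡A' w) A'w)
    }
    where open IsK34Component component

  K34Decomposition-cong : ∀ {A A' k} → (∀ w → A w ≡ A' w) → K34Decomposition A k → K34Decomposition A' k
  K34Decomposition-cong A≡A' ([] empty) = [] (λ w → trans (sym (A≡A' w)) (empty w))
  K34Decomposition-cong A≡A' (_∷_ {C = C} component rest) =
    IsK34Component-cong A≡A' component ∷ K34Decomposition-cong (λ w → cong (_∧ not (C w)) (A≡A' w)) rest

  IsK34Component-nonempty : ∀ {A C} → IsK34Component A C → ∃ λ u → C u ≡ true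
  IsK34Component-nonempty {C = C} component = card-pos⁻¹ C (card>0 (IsK34Component.size component))
    where
    card>0 : Is3or4 (card C) → 0 < card C
    card>0 (inj₁ ≡3) = subst (0 <_) (sym ≡3) (s≤s z≤n)
    card>0 (inj₂ ≡4) = subst (0 <_) (sym ≡4) (s≤s z≤n)

  module _ {A C : VertexSet} (component : IsK34Component A C) {u : Fin n} (Cu : C u ≡ true) where
    open IsK34Component component

    component-N[u] : ∀ {w} → A w ≡ true → N[ u ] w ≡ C w
    component-N[u] {w} Aw = bool-ext to from
      where
      to : N[ u ] w ≡ true → C w ≡ true
      to N[u]w with N[u]∋⁻¹ N[u]w
      ... | inj₁ refl = Cu
      ... | inj₂ uw   = closed u w Cu Aw uw
      from : C w ≡ true → N[ u ] w ≡ true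
      from Cw = dec-true (N[ u ]? w) (member (w ≟ᶠ u))
        where
        member : Dec (w ≡ u) → w ≡ u ⊎ Adj G u w
        member (yes w≡u) = inj₁ w≡u
        member (no  w≢u) = inj₂ (clique u w Cu Cw (λ u≡w → w≢u (sym u≡w)))

    component-∩N[u] : ∀ w → (A ∩ N[ u ]) w ≡ C w
    component-∩N[u] w with A w in Aw
    ... | true  = component-N[u] Aw
    ... | false = sym (≢true⇒≡false (λ Cw → true≢false (subset w Cw) Aw))

    component-∖N[u] : ∀ w → (A ∖ N[ u ]) w ≡ (A ∖ C) w
    component-∖N[u] w with A w in Aw
    ... | true  = cong not (component-N[u] Aw)
    ... | false = refl

  K34Decomposition⇒smallMIS∋ : ∀ {A k} → K34Decomposition A k → ∀ w → Σ (Subset n) λ T →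
    IsMIS A (lookup T) × card (lookup T) ≤ k × (A w ≡ true → lookup T w ≡ true)
  K34Decomposition⇒smallMIS∋ ([] empty) w =
    replicate n outside , ( (λ y T∋y → ⊥-elim (true≢false T∋y (lookup-replicate y outside)))
                          , (λ a _ T∋a → ⊥-elim (true≢false T∋a (lookup-replicate a outside)))
                          , (λ y Ay _ → ⊥-elim (true≢false Ay (empty y))))
                        , ≤-reflexive (trans (card-cong {n} (λ y → lookup-replicate y outside)) (card-false n))
                        , (λ Aw → ⊥-elim (true≢false Aw (empty w)))
  K34Decomposition⇒smallMIS∋ {A} {suc k} (_∷_ {C = C} component rest) w
    with IsK34Component-nonempty component | K34Decomposition⇒smallMIS∋ rest w
  ... | u₀ , Cu₀ | T , mis , small , T∋w = T [ u ]≔ inside , mis' , small' , T'∋w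
    where
    pick : ∃ λ u → C u ≡ true × (C w ≡ true → u ≡ w)
    pick with C w in Cw
    ... | true  = w , Cw , λ _ → refl
    ... | false = u₀ , Cu₀ , λ ()
    u = proj₁ pick
    Cu = proj₁ (proj₂ pick)
    inserted = IsMIS-insert A u T (IsK34Component.subset component u Cu)
                 (IsMIS-cong (λ y → sym (component-∖N[u] component Cu y)) mis)
    mis' : IsMIS A (lookup (T [ u ]≔ inside))
    mis' = proj₂ inserted
    small' : card (lookup (T [ u ]≔ inside)) ≤ suc k
    small' = subst (_≤ suc k) (sym (card-insert u T (proj₁ inserted))) (s≤s small)
    T'∋w : A w ≡ true → lookup (T [ u ]≔ inside) w ≡ true
    T'∋w Aw = member (C w) refl
      where
      member : ∀ b → C w ≡ b → lookup (T [ u ]≔ inside) w ≡ true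
      member true  Cw = subst (λ u → lookup (T [ u ]≔ inside) w ≡ true) (sym (proj₂ (proj₂ pick) Cw))
                              (lookup-insert T w)
      member false Cw = trans (lookup-insert-≢ T (λ w≡u → true≢false (subst (λ z → C z ≡ true) (sym w≡u) Cu) Cw))
                              (T∋w (∧-true Aw (not-false Cw)))

  SharpBound : VertexSet → ℕ → Set
  SharpBound A k = scaled (misCount A k) (card A) k ≤ bound (card A) k
                 × (scaled (misCount A k) (card A) k ≡ bound (card A) k ⇔ K34Decomposition A k)

  misCount-empty : ∀ A k → (∀ w → A w ≡ false) → misCount A k ≡ 1
  misCount-empty A k empty = trans (countSubsets-cong onlyEmpty) (countSubsets-isEmpty n)
    where
    onlyEmpty : ∀ S → isSmallMIS A k S ≡ isEmpty S
    onlyEmpty S = bool-ext to from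
      where
      to : isSmallMIS A k S ≡ true → isEmpty S ≡ true
      to small with isSmallMIS⁻¹ S small
      ... | (S⊆A , _ , _) , _ =
        lookup≡false⇒isEmpty S λ w → ≢true⇒≡false λ Sw → true≢false (S⊆A w Sw) (empty w)
      from : isEmpty S ≡ true → isSmallMIS A k S ≡ true
      from S-empty = isSmallMIS⁺ S
        ( (λ w Sw → ⊥-elim (true≢false Sw (S≡∅ w)))
        , (λ a _ Sa → ⊥-elim (true≢false Sa (S≡∅ a)))
        , (λ w Aw _ → ⊥-elim (true≢false Aw (empty w))))
        (subst (_≤ k) (sym (trans (card-cong S≡∅) (card-false n))) z≤n)
        where S≡∅ = isEmpty⇒lookup≡false S S-empty

  misCount-zero : ∀ A v → A v ≡ true → misCount A 0 ≡ 0
  misCount-zero A v Av = trans (countSubsets-cong none) (countSubsets-false n)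
    where
    none : ∀ S → isSmallMIS A 0 S ≡ false
    none S = ≢true⇒≡false λ small →
      let ((_ , _ , dominates) , size≤0) = isSmallMIS⁻¹ S small
          (u , Su , _) = dominates v Av (S-empty size≤0 v)
      in true≢false Su (S-empty size≤0 u)
      where
      S-empty : card (lookup S) ≤ 0 → ∀ w → lookup S w ≡ false
      S-empty size≤0 w = ≢true⇒≡false λ Sw → n≮0 (<-≤-trans (card-pos (lookup S) w Sw) size≤0)

  sharpBound-empty : ∀ A k → (∀ w → A w ≡ false) → SharpBound A k
  sharpBound-empty A k empty
    rewrite misCount-empty A k empty | trans (card-cong empty) (card-false n) = bound-with k
    where
    bound-with : ∀ k → scaled 1 0 k ≤ bound 0 k × (scaled 1 0 k ≡ bound 0 k ⇔ K34Decomposition A k)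
    bound-with zero    = ≤-refl , mk⇔ (λ _ → [] empty) (λ _ → refl)
    bound-with (suc k) = <⇒≤ (scaled-1-0<bound-0 k) , mk⇔
      (λ eq → ⊥-elim (<-irrefl eq (scaled-1-0<bound-0 k)))
      (λ { (component ∷ _) → let (u , Cu) = IsK34Component-nonempty component in
             ⊥-elim (true≢false (IsK34Component.subset component u Cu) (empty u)) })

  sharpBound-zero : ∀ A v → A v ≡ true → SharpBound A 0
  sharpBound-zero A v Av rewrite misCount-zero A v Av = z≤n , mk⇔
    (λ eq → ⊥-elim (<-irrefl eq (bound>0 (card A) 0)))
    (λ { ([] empty) → ⊥-elim (true≢false Av (empty v)) })

  LocallyMinimalDegree : VertexSet → Fin n → Set
  LocallyMinimalDegree A v = ∀ u → (A ∩ N[ v ]) u ≡ true → card (A ∩ N[ v ]) ≤ card (A ∩ N[ u ])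

  module InductionStep (k : ℕ) (ih : ∀ A → SharpBound A k) (A : VertexSet) (v : Fin n) (Av : A v ≡ true) where

    D : VertexSet
    D = A ∩ N[ v ]

    d m : ℕ
    d = card D
    m = card A

    D∋v : D v ≡ true
    D∋v = ∧-true Av (N[u]∋u v)

    d>0 : 0 < d
    d>0 = card-pos D v D∋v

    Q : Fin n → Subset n → Bool
    Q u S = D u ∧ (lookup S u ∧ isSmallMIS A (suc k) S)

    -- a MIS of G[A] contains v or a neighbour dominating v
    misCount≡⋁Q : misCount A (suc k) ≡ countSubsets (λ S → ⋁ (λ u → Q u S))
    misCount≡⋁Q = countSubsets-cong λ S → bool-ext (to S) (from S)
      where
      to : ∀ S → isSmallMIS A (suc k) S ≡ true → ⋁ (λ u → Q u S) ≡ true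
      to S small with lookup S v in Sv | isSmallMIS⁻¹ S small
      ... | true  | _ = ⋁-intro (λ u → Q u S) v (∧-true D∋v (∧-true Sv small))
      ... | false | (S⊆A , _ , dominates) , _ with dominates v Av Sv
      ...   | y , Sy , yv = ⋁-intro (λ u → Q u S) y
                              (∧-true (∧-true (S⊆A y Sy) (N[u]∋adj (Graph.sym G yv))) (∧-true Sy small))
      from : ∀ S → ⋁ (λ u → Q u S) ≡ true → isSmallMIS A (suc k) S ≡ true
      from S ⋁Q = let (u , Qu) = ⋁-elim (λ u → Q u S) ⋁Q in ∧-trueʳ {lookup S u} (∧-trueʳ {D u} Qu)

    countSubsets-Q : ∀ u → D u ≡ true → countSubsets (Q u) ≡ misCount (A ∖ N[ u ]) k
    countSubsets-Q u Du = trans (countSubsets-cong (λ S → cong (_∧ (lookup S u ∧ isSmallMIS A (suc k) S)) Du))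
                                (misCount-∋ A u k (∧-trueˡ Du))

    countSubsets-Q-∉ : ∀ u → D u ≡ false → countSubsets (Q u) ≡ 0
    countSubsets-Q-∉ u Du = trans (countSubsets-cong (λ S → cong (_∧ (lookup S u ∧ isSmallMIS A (suc k) S)) Du))
                                  (countSubsets-false n)

    term : Fin n → ℕ
    term u = d * scaled (countSubsets (Q u)) m (suc k)

    term-∉ : ∀ u → D u ≡ false → term u ≡ 0
    term-∉ u Du rewrite countSubsets-Q-∉ u Du = *-zeroʳ d

    term≡ : ∀ u → D u ≡ true →
      term u ≡ d * scaled (misCount (A ∖ N[ u ]) k) (card (A ∩ N[ u ]) + card (A ∖ N[ u ])) (suc k)
    term≡ u Du rewrite countSubsets-Q u Du | card-∩+∖ A N[ u ] = refl

    term≤ : LocallyMinimalDegree A v → ∀ u → D u ≡ true → term u ≤ bound m (suc k)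
    term≤ minimal u Du = begin
      term u                                          ≡⟨ term≡ u Du ⟩
      d * scaled (misCount (A ∖ N[ u ]) k) (μ + r) (suc k)
        ≤⟨ scaled-step-≤ d μ r k (misCount (A ∖ N[ u ]) k) (minimal u Du) (proj₁ (ih (A ∖ N[ u ]))) ⟩
      bound (μ + r) (suc k)                           ≡⟨ cong (λ m → bound m (suc k)) (card-∩+∖ A N[ u ]) ⟩
      bound m (suc k)                                 ∎
      where
      open ≤-Reasoning
      μ = card (A ∩ N[ u ])
      r = card (A ∖ N[ u ])

    sumQ : ℕ
    sumQ = sum (λ u → countSubsets (Q u))

    union-bound : d * scaled (misCount A (suc k)) m (suc k) ≤ d * scaled sumQ m (suc k)
    union-bound = *-monoʳ-≤ d (scaled-monoˡ-≤ m (suc k)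
                    (subst (_≤ sumQ) (sym misCount≡⋁Q) (countSubsets-⋁ Q)))

    scaled-Σ : d * scaled sumQ m (suc k) ≡ sum term
    scaled-Σ = trans (cong (d *_) (scaled-sum (λ u → countSubsets (Q u)) m (suc k)))
                     (*-distribˡ-sum d (λ u → scaled (countSubsets (Q u)) m (suc k)))

    sum-term≤ : LocallyMinimalDegree A v → sum term ≤ d * bound m (suc k)
    sum-term≤ minimal = sum-≤-card* D term (bound m (suc k)) (term≤ minimal) term-∉

    misCount-≤ : LocallyMinimalDegree A v → scaled (misCount A (suc k)) m (suc k) ≤ bound m (suc k)
    misCount-≤ minimal = *-cancelˡ-≤ d {{>-nonZero d>0}}
      (≤-trans union-bound (subst (_≤ d * bound m (suc k)) (sym scaled-Σ) (sum-term≤ minimal)))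

    misCount-≡⁻¹ : LocallyMinimalDegree A v → scaled (misCount A (suc k)) m (suc k) ≡ bound m (suc k) →
      PairwiseDisjoint Q ×
      (∀ u → D u ≡ true → card (A ∩ N[ u ]) ≡ d × Is3or4 d × K34Decomposition (A ∖ N[ u ]) k)
    misCount-≡⁻¹ minimal eq = disjoint , tight
      where
      upper : d * scaled sumQ m (suc k) ≤ d * bound m (suc k)
      upper = subst (_≤ d * bound m (suc k)) (sym scaled-Σ) (sum-term≤ minimal)
      ends : d * scaled (misCount A (suc k)) m (suc k) ≡ d * bound m (suc k)
      ends = cong (d *_) eq
      union-tight : d * scaled (misCount A (suc k)) m (suc k) ≡ d * scaled sumQ m (suc k)
      union-tight = ≤-antisym union-bound (subst (d * scaled sumQ m (suc k) ≤_) (sym ends) upper)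
      disjoint : PairwiseDisjoint Q
      disjoint = countSubsets-⋁-tight Q (trans (sym misCount≡⋁Q)
                   (scaled-cancelˡ-≡ m (suc k) (*-cancelˡ-≡ _ _ d {{>-nonZero d>0}} union-tight)))
      sum-tight : sum term ≡ d * bound m (suc k)
      sum-tight = trans (sym scaled-Σ) (trans (sym union-tight) ends)
      tight : ∀ u → D u ≡ true → card (A ∩ N[ u ]) ≡ d × Is3or4 d × K34Decomposition (A ∖ N[ u ]) k
      tight u Du = sym d≡μ , subst Is3or4 (sym d≡μ) μ∈34 , Equivalence.to (proj₂ (ih (A ∖ N[ u ]))) rest-tight
        where
        μ = card (A ∩ N[ u ])
        r = card (A ∖ N[ u ])
        term-tight : d * scaled (misCount (A ∖ N[ u ]) k) (μ + r) (suc k) ≡ bound (μ + r) (suc k)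
        term-tight = trans (sym (term≡ u Du))
                       (trans (sum-≡-card*⁻¹ D term (bound m (suc k)) (term≤ minimal) term-∉ sum-tight u Du)
                              (cong (λ m → bound m (suc k)) (sym (card-∩+∖ A N[ u ]))))
        step = scaled-step-≡⁻¹ d μ r k (misCount (A ∖ N[ u ]) k) (minimal u Du) (proj₁ (ih (A ∖ N[ u ]))) term-tight
        d≡μ = proj₁ step
        μ∈34 = proj₁ (proj₂ step)
        rest-tight = proj₂ (proj₂ step)

    misCount-≡ : PairwiseDisjoint Q → (∀ u → D u ≡ true → term u ≡ bound m (suc k)) →
      scaled (misCount A (suc k)) m (suc k) ≡ bound m (suc k)
    misCount-≡ disjoint term-tight = *-cancelˡ-≡ _ _ d {{>-nonZero d>0}} (begin
      d * scaled (misCount A (suc k)) m (suc k)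
        ≡⟨ cong (λ x → d * scaled x m (suc k)) (trans misCount≡⋁Q (countSubsets-⋁-disjoint Q disjoint)) ⟩
      d * scaled sumQ m (suc k)   ≡⟨ scaled-Σ ⟩
      sum term                    ≡⟨ sum-≡-card* D term (bound m (suc k)) term-tight term-∉ ⟩
      d * bound m (suc k)         ∎)
      where open ≡-Reasoning

  equality⇒K34Decomposition : ∀ k → (∀ A → SharpBound A k) →
    ∀ A v (Av : A v ≡ true) → LocallyMinimalDegree A v →
    scaled (misCount A (suc k)) (card A) (suc k) ≡ bound (card A) (suc k) → K34Decomposition A (suc k)
  equality⇒K34Decomposition k ih A v Av minimal eq = component ∷ K34Decomposition-cong A∖N[v]≡A∖D A∖N[v]-decomposed
    where
    open InductionStep k ih A v Av
    disjoint = proj₁ (misCount-≡⁻¹ minimal eq)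
    tight = proj₂ (misCount-≡⁻¹ minimal eq)

    -- u, w ∈ D non-adjacent would lie in a common small MIS, contradicting disjointness
    clique : ∀ u w → D u ≡ true → D w ≡ true → u ≢ w → Adj G u w
    clique u w Du Dw u≢w = decidable-stable (adj? G u w) λ ¬uw →
      let (T , mis , small , T∋w) = K34Decomposition⇒smallMIS∋ (proj₂ (proj₂ (tight u Du))) w
          (Tu , mis') = IsMIS-insert A u T (∧-trueˡ Du) mis
          small' = isSmallMIS⁺ (T [ u ]≔ inside) mis' (subst (_≤ suc k) (sym (card-insert u T Tu)) (s≤s small))
          A∖N[u]∋w = ∧-true (∧-trueˡ Dw) (not-false (N[u]∌ (λ w≡u → u≢w (sym w≡u)) ¬uw))
          S∋w = trans (lookup-insert-≢ T (λ w≡u → u≢w (sym w≡u))) (T∋w A∖N[u]∋w)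
      in disjoint (T [ u ]≔ inside) u w u≢w (∧-true Du (∧-true (lookup-insert T u) small'))
                                            (∧-true Dw (∧-true S∋w small'))

    -- D is a clique inside A ∩ N[u], and the two have the same size
    closed : ∀ u w → D u ≡ true → A w ≡ true → Adj G u w → D w ≡ true
    closed u w Du Aw uw with D w in Dw
    ... | true  = refl
    ... | false = ⊥-elim (<-irrefl (sym (proj₁ (tight u Du))) (card-mono-< D⊆A∩N[u] w (∧-true Aw (N[u]∋adj uw)) Dw))
      where
      D⊆A∩N[u] : D ⊆ᵇ (A ∩ N[ u ])
      D⊆A∩N[u] y Dy = ∧-true (∧-trueˡ Dy) (dec-true (N[ u ]? y) (member (y ≟ᶠ u)))
        where
        member : Dec (y ≡ u) → y ≡ u ⊎ Adj G u y
        member (yes y≡u) = inj₁ y≡u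
        member (no  y≢u) = inj₂ (clique u y Du Dy (λ u≡y → y≢u (sym u≡y)))

    component : IsK34Component A D
    component = record
      { subset = λ w Dw → ∧-trueˡ Dw
      ; size   = proj₁ (proj₂ (tight v D∋v))
      ; clique = clique
      ; closed = closed
      }

    A∖N[v]≡A∖D : ∀ w → (A ∖ N[ v ]) w ≡ (A ∖ D) w
    A∖N[v]≡A∖D w = ∧-not-∧ (A w) (N[ v ] w)

    A∖N[v]-decomposed : K34Decomposition (A ∖ N[ v ]) k
    A∖N[v]-decomposed = proj₂ (proj₂ (tight v D∋v))

  K34Decomposition⇒equality : ∀ k → (∀ A → SharpBound A k) → ∀ A → K34Decomposition A (suc k) →
    scaled (misCount A (suc k)) (card A) (suc k) ≡ bound (card A) (suc k)
  K34Decomposition⇒equality k ih A (_∷_ {C = C} component rest) = misCount-≡ disjoint term-tight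
    where
    open IsK34Component component
    v = proj₁ (IsK34Component-nonempty component)
    Cv = proj₂ (IsK34Component-nonempty component)
    open InductionStep k ih A v (subset v Cv)

    D≡C : ∀ u → D u ≡ C u
    D≡C = component-∩N[u] component Cv

    disjoint : PairwiseDisjoint Q
    disjoint S u w u≢w Qu Qw =
      let ((_ , independent , _) , _) = isSmallMIS⁻¹ S (∧-trueʳ {lookup S u} (∧-trueʳ {D u} Qu))
      in independent u w (∧-trueˡ (∧-trueʳ {D u} Qu)) (∧-trueˡ (∧-trueʳ {D w} Qw))
           (clique u w (trans (sym (D≡C u)) (∧-trueˡ Qu)) (trans (sym (D≡C w)) (∧-trueˡ Qw)) u≢w)

    d∈34 : Is3or4 d
    d∈34 = ⊎-map (trans (card-cong D≡C)) (trans (card-cong D≡C)) size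

    term-tight : ∀ u → D u ≡ true → term u ≡ bound m (suc k)
    term-tight u Du = begin
      term u                                       ≡⟨ term≡ u Du ⟩
      d * scaled x (μ + r) (suc k)                 ≡⟨ cong (λ j → d * scaled x (j + r) (suc k)) μ≡d ⟩
      d * scaled x (d + r) (suc k)                 ≡⟨ scaled-step-≡ d r k x d∈34 rest-tight ⟩
      bound (d + r) (suc k)                        ≡⟨ cong (λ j → bound (j + r) (suc k)) μ≡d ⟨
      bound (μ + r) (suc k)                        ≡⟨ cong (λ m → bound m (suc k)) (card-∩+∖ A N[ u ]) ⟩
      bound m (suc k)                              ∎
      where
      open ≡-Reasoning
      Cu = trans (sym (D≡C u)) Du
      x = misCount (A ∖ N[ u ]) k
      μ = card (A ∩ N[ u ])
      r = card (A ∖ N[ u ])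
      μ≡d : μ ≡ d
      μ≡d = trans (card-cong (component-∩N[u] component Cu)) (sym (card-cong D≡C))
      A∖N[u]≡A∖C = component-∖N[u] component Cu
      rest-tight : scaled x r k ≡ bound r k
      rest-tight = subst₂ (λ x r → scaled x r k ≡ bound r k)
                     (sym (misCount-cong k A∖N[u]≡A∖C)) (sym (card-cong A∖N[u]≡A∖C))
                     (Equivalence.from (proj₂ (ih (A ∖ C))) rest)

  sharpBound : ∀ k A → SharpBound A k
  sharpBound k A with any? (λ w → A w ≟ᵇ true)
  ... | no none = sharpBound-empty A k (λ w → ≢true⇒≡false (λ Aw → none (w , Aw)))
  sharpBound zero    A | yes (w , Aw) = sharpBound-zero A w Aw
  sharpBound (suc k) A | yes (w , Aw) with argmin A (λ u → card (A ∩ N[ u ])) w Aw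
  ... | v , Av , minimal =
    InductionStep.misCount-≤ k (sharpBound k) A v Av locallyMinimal ,
    mk⇔ (equality⇒K34Decomposition k (sharpBound k) A v Av locallyMinimal)
        (K34Decomposition⇒equality k (sharpBound k) A)
    where
    locallyMinimal : LocallyMinimalDegree A v
    locallyMinimal u Du = minimal u (∧-trueˡ Du)

  everything : VertexSet
  everything _ = true

  MaximalIndependent⇒IsMIS : ∀ S → MaximalIndependent G S → IsMIS everything (lookup S)
  MaximalIndependent⇒IsMIS S (independent , maximal) = (λ _ _ → refl) , independent-S , dominates
    where
    independent-S : IsIndependent (lookup S)
    independent-S u w Su Sw = independent u w (lookup⇒∈ Su) (lookup⇒∈ Sw)
    dominates : Dominates (lookup S) everything
    dominates w _ Sw = decidable-stable (any? λ u → (lookup S u ≟ᵇ true) ×-dec adj? G u w)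
                         λ undominated → true≢false (undominated⇒∈ w undominated) Sw
      where
      -- otherwise S ∪ {w} would be a larger independent set
      undominated⇒∈ : ∀ w → ¬ (∃ λ u → lookup S u ≡ true × Adj G u w) → lookup S w ≡ true
      undominated⇒∈ w undominated = ∈⇒lookup (maximal T independent-T S⊆T (lookup⇒∈ (lookup-insert S w)))
        where
        T = S [ w ]≔ inside
        independent-T : Independent G T
        independent-T a b T∋a T∋b
          with lookup-insert⁻¹ S w a (∈⇒lookup T∋a) | lookup-insert⁻¹ S w b (∈⇒lookup T∋b)
        ... | inj₁ refl     | inj₁ refl     = irrefl G
        ... | inj₁ refl     | inj₂ (_ , Sb) = λ ab → undominated (b , Sb , Graph.sym G ab)
        ... | inj₂ (_ , Sa) | inj₁ refl     = λ ab → undominated (a , Sa , ab)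
        ... | inj₂ (_ , Sa) | inj₂ (_ , Sb) = independent-S a b Sa Sb
        S⊆T : S Subset.⊆ T
        S⊆T {y} S∋y with y ≟ᶠ w
        ... | yes refl = lookup⇒∈ (lookup-insert S w)
        ... | no  y≢w  = lookup⇒∈ (trans (lookup-insert-≢ S y≢w) (∈⇒lookup S∋y))

  IsMIS⇒MaximalIndependent : ∀ S → IsMIS everything (lookup S) → MaximalIndependent G S
  IsMIS⇒MaximalIndependent S (_ , independent , dominates) =
    (λ u w S∋u S∋w → independent u w (∈⇒lookup S∋u) (∈⇒lookup S∋w)) , maximal
    where
    maximal : ∀ T → Independent G T → S Subset.⊆ T → T Subset.⊆ S
    maximal T independent-T S⊆T {y} T∋y = lookup⇒∈ (≢false⇒≡true λ Sy →
      let (u , Su , uy) = dominates y refl Sy in independent-T u y (S⊆T (lookup⇒∈ Su)) T∋y uy)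

  mis≤≡misCount : ∀ k → mis≤ G k ≡ misCount everything k
  mis≤≡misCount k = countSubsets-cong λ S →
    does-⇔ (maximalIndependent? G S ×-dec (∣ S ∣ ≤? k)) (isMIS? everything (lookup S) ×-dec (card (lookup S) ≤? k))
      (λ (maximal , small) → MaximalIndependent⇒IsMIS S maximal , subst (_≤ k) (card-lookup S) small)
      (λ (mis , small) → IsMIS⇒MaximalIndependent S mis , subst (_≤ k) (sym (card-lookup S)) small)

  -- labels are natural numbers rather than elements of Fin k, since vertices outside A need a label too
  record K34Labelling (A : VertexSet) (k : ℕ) : Set where
    field
      label    : Fin n → ℕ
      bounded  : ∀ w → A w ≡ true → label w < k
      classes  : ∀ i → i < k → Is3or4 (card (λ w → A w ∧ does (label w ≟ i)))
      adjacent : ∀ u w → A u ≡ true → A w ≡ true → Adj G u w ⇔ (u ≢ w × label u ≡ label w)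

  module ExtendLabelling {A C k} (component : IsK34Component A C) (restLabelling : K34Labelling (A ∖ C) k) where
    open IsK34Component component
    private module R = K34Labelling restLabelling

    label : Fin n → ℕ
    label w = if C w then k else R.label w

    label-C : ∀ {w} → C w ≡ true → label w ≡ k
    label-C Cw rewrite Cw = refl

    label-∉C : ∀ {w} → C w ≡ false → label w ≡ R.label w
    label-∉C Cw rewrite Cw = refl

    label-∉C-< : ∀ {w} → A w ≡ true → C w ≡ false → label w < k
    label-∉C-< Aw Cw = subst (_< k) (sym (label-∉C Cw)) (R.bounded _ (∧-true Aw (not-false Cw)))

    bounded : ∀ w → A w ≡ true → label w < suc k
    bounded w Aw with true⊎false (C w)
    ... | inj₁ Cw = subst (_< suc k) (sym (label-C Cw)) (n<1+n k)
    ... | inj₂ Cw = m<n⇒m<1+n (label-∉C-< Aw Cw)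

    classes : ∀ i → i < suc k → Is3or4 (card (λ w → A w ∧ does (label w ≟ i)))
    classes i i<1+k with i ≟ k
    ... | yes refl = subst Is3or4 (card-cong C≡class) size
      where
      C≡class : ∀ w → C w ≡ (A w ∧ does (label w ≟ k))
      C≡class w = bool-ext (λ Cw → ∧-true (subset w Cw) (dec-true (label w ≟ k) (label-C Cw))) to
        where
        to : A w ∧ does (label w ≟ k) ≡ true → C w ≡ true
        to class∋w = ≢false⇒≡true λ Cw →
          <⇒≢ (label-∉C-< (∧-trueˡ class∋w) Cw) (dec-true⁻¹ (label w ≟ k) (∧-trueʳ {A w} class∋w))
    ... | no  i≢k  = subst Is3or4 (card-cong restClass≡class) (R.classes i (≤∧≢⇒< (≤-pred i<1+k) i≢k))
      where
      restClass≡class : ∀ w → ((A ∖ C) w ∧ does (R.label w ≟ i)) ≡ (A w ∧ does (label w ≟ i))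
      restClass≡class w = bool-ext to from
        where
        to : (A ∖ C) w ∧ does (R.label w ≟ i) ≡ true → A w ∧ does (label w ≟ i) ≡ true
        to restClass∋w = let Cw = not-true (∧-trueʳ {A w} (∧-trueˡ restClass∋w)) in
          ∧-true (∧-trueˡ (∧-trueˡ restClass∋w))
                 (dec-true (label w ≟ i) (trans (label-∉C Cw)
                   (dec-true⁻¹ (R.label w ≟ i) (∧-trueʳ {(A ∖ C) w} restClass∋w))))
        from : A w ∧ does (label w ≟ i) ≡ true → (A ∖ C) w ∧ does (R.label w ≟ i) ≡ true
        from class∋w with true⊎false (C w)
        ... | inj₁ Cw = ⊥-elim (i≢k (trans (sym (dec-true⁻¹ (label w ≟ i) (∧-trueʳ {A w} class∋w))) (label-C Cw)))
        ... | inj₂ Cw = ∧-true (∧-true (∧-trueˡ class∋w) (not-false Cw))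
                          (dec-true (R.label w ≟ i) (trans (sym (label-∉C Cw))
                            (dec-true⁻¹ (label w ≟ i) (∧-trueʳ {A w} class∋w))))

    adjacent : ∀ u w → A u ≡ true → A w ≡ true → Adj G u w ⇔ (u ≢ w × label u ≡ label w)
    adjacent u w Au Aw with true⊎false (C u) | true⊎false (C w)
    ... | inj₁ Cu | inj₁ Cw = mk⇔
      (λ uw → (λ { refl → irrefl G uw }) , trans (label-C Cu) (sym (label-C Cw)))
      (λ (u≢w , _) → clique u w Cu Cw u≢w)
    ... | inj₁ Cu | inj₂ Cw = mk⇔
      (λ uw → ⊥-elim (true≢false (closed u w Cu Aw uw) Cw))
      (λ (_ , u~w) → ⊥-elim (<⇒≢ (label-∉C-< Aw Cw) (trans (sym u~w) (label-C Cu))))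
    ... | inj₂ Cu | inj₁ Cw = mk⇔
      (λ uw → ⊥-elim (true≢false (closed w u Cw Au (Graph.sym G uw)) Cu))
      (λ (_ , u~w) → ⊥-elim (<⇒≢ (label-∉C-< Au Cu) (trans u~w (label-C Cw))))
    ... | inj₂ Cu | inj₂ Cw = mk⇔
      (λ uw → let (u≢w , u~w) = Equivalence.to restAdjacent uw in
              u≢w , trans (label-∉C Cu) (trans u~w (sym (label-∉C Cw))))
      (λ (u≢w , u~w) → Equivalence.from restAdjacent (u≢w , trans (sym (label-∉C Cu)) (trans u~w (label-∉C Cw))))
      where
      restAdjacent = R.adjacent u w (∧-true Au (not-false Cu)) (∧-true Aw (not-false Cw))

    labelling : K34Labelling A (suc k)
    labelling = record { label = label ; bounded = bounded ; classes = classes ; adjacent = adjacent }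

  K34Decomposition⇒K34Labelling : ∀ {A k} → K34Decomposition A k → K34Labelling A k
  K34Decomposition⇒K34Labelling ([] empty) = record
    { label    = λ _ → 0
    ; bounded  = λ w Aw → ⊥-elim (true≢false Aw (empty w))
    ; classes  = λ _ ()
    ; adjacent = λ u _ Au → ⊥-elim (true≢false Au (empty u))
    }
  K34Decomposition⇒K34Labelling (component ∷ rest) =
    ExtendLabelling.labelling component (K34Decomposition⇒K34Labelling rest)

  K34Labelling⇒K34Decomposition : ∀ k {A} → K34Labelling A k → K34Decomposition A k
  K34Labelling⇒K34Decomposition zero    labelling =
    [] (λ w → ≢true⇒≡false (λ Aw → n≮0 (K34Labelling.bounded labelling w Aw)))
  K34Labelling⇒K34Decomposition (suc k) {A} labelling = component ∷ K34Labelling⇒K34Decomposition k rest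
    where
    open K34Labelling labelling

    C : VertexSet
    C w = A w ∧ does (label w ≟ k)

    label-C : ∀ {w} → C w ≡ true → label w ≡ k
    label-C {w} Cw = dec-true⁻¹ (label w ≟ k) (∧-trueʳ {A w} Cw)

    label-∉C : ∀ {w} → A w ≡ true → C w ≡ false → label w ≢ k
    label-∉C {w} Aw Cw label≡k = true≢false (∧-true Aw (dec-true (label w ≟ k) label≡k)) Cw

    component : IsK34Component A C
    component = record
      { subset = λ w Cw → ∧-trueˡ Cw
      ; size   = classes k (n<1+n k)
      ; clique = λ u w Cu Cw u≢w →
          Equivalence.from (adjacent u w (∧-trueˡ Cu) (∧-trueˡ Cw)) (u≢w , trans (label-C Cu) (sym (label-C Cw)))
      ; closed = λ u w Cu Aw uw → ∧-true Aw (dec-true (label w ≟ k)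
          (trans (sym (proj₂ (Equivalence.to (adjacent u w (∧-trueˡ Cu) Aw) uw))) (label-C Cu)))
      }

    rest : K34Labelling (A ∖ C) k
    rest = record
      { label    = label
      ; bounded  = λ w A∖C∋w → let Aw = ∧-trueˡ A∖C∋w in
          ≤∧≢⇒< (≤-pred (bounded w Aw)) (label-∉C Aw (not-true (∧-trueʳ {A w} A∖C∋w)))
      ; classes  = λ i i<k → subst Is3or4 (card-cong (class≡restClass i<k)) (classes i (m<n⇒m<1+n i<k))
      ; adjacent = λ u w A∖C∋u A∖C∋w → adjacent u w (∧-trueˡ A∖C∋u) (∧-trueˡ A∖C∋w)
      }
      where
      class≡restClass : ∀ {i} → i < k → ∀ w → (A w ∧ does (label w ≟ i)) ≡ ((A ∖ C) w ∧ does (label w ≟ i))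
      class≡restClass {i} i<k w = bool-ext to from
        where
        to : A w ∧ does (label w ≟ i) ≡ true → (A ∖ C) w ∧ does (label w ≟ i) ≡ true
        to class∋w = ∧-true (∧-true Aw (not-false (≢true⇒≡false λ Cw →
                                <⇒≢ i<k (trans (sym label≡i) (label-C Cw)))))
                            (∧-trueʳ {A w} class∋w)
          where
          Aw = ∧-trueˡ class∋w
          label≡i = dec-true⁻¹ (label w ≟ i) (∧-trueʳ {A w} class∋w)
        from : (A ∖ C) w ∧ does (label w ≟ i) ≡ true → A w ∧ does (label w ≟ i) ≡ true
        from restClass∋w = ∧-true (∧-trueˡ (∧-trueˡ restClass∋w)) (∧-trueʳ {(A ∖ C) w} restClass∋w)

  K34Labelling⇔IsDisjointUnionOfK3K4 : ∀ k → K34Labelling everything k ⇔ IsDisjointUnionOfK3K4 G k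
  K34Labelling⇔IsDisjointUnionOfK3K4 k = mk⇔ to from
    where
    to : K34Labelling everything k → IsDisjointUnionOfK3K4 G k
    to labelling = c , classes′ , adjacent′
      where
      open K34Labelling labelling
      c : Fin n → Fin k
      c w = fromℕ< (bounded w refl)
      c≡⇔ : ∀ w i → does (c w ≟ᶠ i) ≡ (true ∧ does (label w ≟ toℕ i))
      c≡⇔ w i = does-⇔ (c w ≟ᶠ i) (label w ≟ toℕ i)
        (λ c≡i → trans (sym (toℕ-fromℕ< (bounded w refl))) (cong toℕ c≡i))
        (λ label≡i → toℕ-injective (trans (toℕ-fromℕ< (bounded w refl)) label≡i))
      classes′ : ∀ i → Is3or4 ∣ tabulate (λ v → does (c v ≟ᶠ i)) ∣
      classes′ i = subst Is3or4 (sym (trans (card-tabulate (λ v → does (c v ≟ᶠ i))) (card-cong (λ w → c≡⇔ w i))))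
                     (classes (toℕ i) (toℕ<n i))
      adjacent′ : ∀ u v → Adj G u v ⇔ (u ≢ v × c u ≡ c v)
      adjacent′ u v = mk⇔
        (λ uv → let (u≢v , u~v) = Equivalence.to (adjacent u v refl refl) uv in
                u≢v , toℕ-injective (trans (toℕ-fromℕ< _) (trans u~v (sym (toℕ-fromℕ< _)))))
        (λ (u≢v , cu≡cv) → Equivalence.from (adjacent u v refl refl)
                (u≢v , trans (sym (toℕ-fromℕ< _)) (trans (cong toℕ cu≡cv) (toℕ-fromℕ< _))))

    from : IsDisjointUnionOfK3K4 G k → K34Labelling everything k
    from (c , classes′ , adjacent′) = record
      { label    = λ w → toℕ (c w)
      ; bounded  = λ w _ → toℕ<n (c w)
      ; classes  = classes
      ; adjacent = λ u w _ _ → mk⇔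
          (λ uw → let (u≢w , cu≡cw) = Equivalence.to (adjacent′ u w) uw in u≢w , cong toℕ cu≡cw)
          (λ (u≢w , u~w) → Equivalence.from (adjacent′ u w) (u≢w , toℕ-injective u~w))
      }
      where
      classes : ∀ i → i < k → Is3or4 (card (λ w → true ∧ does (toℕ (c w) ≟ i)))
      classes i i<k = subst Is3or4 (trans (card-tabulate (λ v → does (c v ≟ᶠ fromℕ< i<k))) (card-cong c≡⇔))
                        (classes′ (fromℕ< i<k))
        where
        c≡⇔ : ∀ w → does (c w ≟ᶠ fromℕ< i<k) ≡ (true ∧ does (toℕ (c w) ≟ i))
        c≡⇔ w = does-⇔ (c w ≟ᶠ fromℕ< i<k) (toℕ (c w) ≟ i)
          (λ c≡i → trans (cong toℕ c≡i) (toℕ-fromℕ< i<k))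
          (λ label≡i → toℕ-injective (trans label≡i (sym (toℕ-fromℕ< i<k))))

  K34Decomposition⇔IsDisjointUnionOfK3K4 : ∀ k → K34Decomposition everything k ⇔ IsDisjointUnionOfK3K4 G k
  K34Decomposition⇔IsDisjointUnionOfK3K4 k =
    K34Labelling⇔IsDisjointUnionOfK3K4 k ⇔-∘ mk⇔ K34Decomposition⇒K34Labelling (K34Labelling⇒K34Decomposition k)

theorem1 : ∀ (n : ℕ) (G : Graph n) (k : ℕ) →
    (mis≤ G k * 3 ^ (n ∸ 4 * k) * 4 ^ (3 * k ∸ n) ≤ 3 ^ (4 * k ∸ n) * 4 ^ (n ∸ 3 * k))
    × (mis≤ G k * 3 ^ (n ∸ 4 * k) * 4 ^ (3 * k ∸ n) ≡ 3 ^ (4 * k ∸ n) * 4 ^ (n ∸ 3 * k)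
       ⇔ IsDisjointUnionOfK3K4 G k)
theorem1 n G k =
  scaled≤bound⇒ (mis≤ G k) n k (proj₁ sharp) ,
  K34Decomposition⇔IsDisjointUnionOfK3K4 G k ⇔-∘ (proj₂ sharp ⇔-∘ ⇔-sym (scaled≡bound⇔ (mis≤ G k) n k))
  where
  sharp : scaled (mis≤ G k) n k ≤ bound n k
        × (scaled (mis≤ G k) n k ≡ bound n k ⇔ K34Decomposition G (everything G) k)
  sharp = subst₂ (λ x m → scaled x m k ≤ bound m k × (scaled x m k ≡ bound m k ⇔ K34Decomposition G (everything G) k))
            (sym (mis≤≡misCount G k)) (card-true n) (sharpBound G k (everything G))
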